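{- Let $x$ be a positive integer and let $q,r$ be positive integers with $q\mid x$ and $r\mid x$. Then \[ \sum_{m=1}^x\sum_{a=1}^x c_q(m-a)\,S(a,m;r)=\begin{cases} x^2\,\widetilde{\varphi}(q), & q=r,\\ 0, & \text{otherwise}.\end{cases} \]
   Context: For a positive integer $q$ and any integer $n$, the Ramanujan sum is $c_q(n)=\sum_{1\le k\le q,\ \gcd(k,q)=1}\exp(2\pi i kn/q)$. For integers $m,n$, the Kloosterman sum is $S(m,n;r)=\sum_{1\le k\le r,\ \gcd(k,r)=1}\exp\bigl(\frac{2\pi i}{r}(mk+nk^*)\bigr)$, where $k^*$ denotes an inverse of $k$ modulo $r$. Also $\widetilde{\varphi}(q)=\#\{1\le k\le q:\ \gcd(k,q)=1,\ k+k^*\equiv 0\pmod q\}$, with $k^*$ an inverse of $k$ modulo $q$. -}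

module Defs where

open import Data.Bool using (Bool; true; false; _∧_; not; if_then_else_)
open import Data.Nat as ℕ using (ℕ; zero; suc; _+_; _*_; _∸_; NonZero)
open import Data.Nat.DivMod using (_/_; _%_)
open import Data.Nat.GCD using (gcd)
open import Data.Nat.Divisibility using (_∣?_)
open import Data.Nat.Primality using (prime?)
open import Data.Integer as ℤ using (ℤ; +_; -_)
open import Data.List using (List; []; _∷_; map; foldr; upTo; length; filterᵇ; replicate; _++_)
open import Data.Product using (Σ)
open import Relation.Nullary using (does)
open import Relation.Binary.PropositionalEquality using (_≡_)

range : ℕ → List ℕ
range n = map suc (upTo n)

coprime? : ℕ → ℕ → Bool
coprime? k n = does (gcd k n ℕ.≟ 1)

-- an inverse of l modulo r: the least j in [1..r] with l*j ≡ 1 (mod r)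
-- (0 if none exists; only used for gcd l r = 1, where one exists)
inv : (r : ℕ) .{{_ : NonZero r}} → ℕ → ℕ
inv r l with filterᵇ (λ j → does ((l * j) % r ℕ.≟ 1 % r)) (range r)
... | []    = 0
... | j ∷ _ = j

φ̃ : (q : ℕ) .{{_ : NonZero q}} → ℕ
φ̃ q = length (filterᵇ (λ k → coprime? k q ∧ does ((k + inv q k) % q ℕ.≟ 0)) (range q))

-- Integer polynomials as coefficient lists (lowest degree first)

Poly : Set
Poly = List ℤ

_+ₚ_ : Poly → Poly → Poly
[]       +ₚ q        = q
(a ∷ p)  +ₚ []       = a ∷ p
(a ∷ p)  +ₚ (b ∷ q)  = (a ℤ.+ b) ∷ (p +ₚ q)

scaleₚ : ℤ → Poly → Poly
scaleₚ c = map (c ℤ.*_)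

_*ₚ_ : Poly → Poly → Poly
[]      *ₚ q = []
(c ∷ p) *ₚ q = scaleₚ c q +ₚ (+ 0 ∷ (p *ₚ q))

negₚ : Poly → Poly
negₚ = map (-_)

constₚ : ℤ → Poly
constₚ c = c ∷ []

monoₚ : ℕ → Poly
monoₚ e = replicate e (+ 0) ++ (+ 1 ∷ [])

sumₚ : List Poly → Poly
sumₚ = foldr _+ₚ_ []

prodₚ : List Poly → Poly
prodₚ = foldr _*ₚ_ (constₚ (+ 1))

coeff : Poly → ℕ → ℤ
coeff []      _       = + 0
coeff (a ∷ p) zero    = a
coeff (a ∷ p) (suc i) = coeff p i

-- equality of polynomials (ignoring trailing zeros)
_≈ₚ_ : Poly → Poly → Set
p ≈ₚ q = ∀ i → coeff p i ≡ coeff q i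

squarefree : ℕ → Bool
squarefree n = allᵇ (λ d → not (does ((d * d) ∣? n))) (map (λ i → 2 + i) (upTo n))
  where
  allᵇ : (ℕ → Bool) → List ℕ → Bool
  allᵇ p = foldr (λ d b → p d ∧ b) true

numPrimeDivisors : ℕ → ℕ
numPrimeDivisors n = length (filterᵇ (λ p → does (prime? p) ∧ does (p ∣? n)) (range n))

μ : ℕ → ℤ
μ n = if squarefree n
        then (if does (numPrimeDivisors n % 2 ℕ.≟ 0) then + 1 else - (+ 1))
        else + 0

cycₚ : ℕ → Poly
cycₚ d = monoₚ d +ₚ constₚ (- (+ 1))

divisors : ℕ → List ℕ
divisors x = filterᵇ (λ d → does (d ∣? x)) (range x)

-- Φ_x = ∏_{d ∣ x} (X^d - 1)^{μ(x/d)} = cycNum x / cycDen x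
cycNum : ℕ → Poly
cycNum x = prodₚ (map (λ i → cycₚ (suc i))
             (filterᵇ (λ i → does (suc i ∣? x) ∧ does (μ (x / suc i) ℤ.≟ + 1)) (upTo x)))

cycDen : ℕ → Poly
cycDen x = prodₚ (map (λ i → cycₚ (suc i))
             (filterᵇ (λ i → does (suc i ∣? x) ∧ does (μ (x / suc i) ℤ.≟ - (+ 1))) (upTo x)))

-- P(ζ_x) = 0 in ℂ for ζ_x = exp(2πi/x), i.e. Φ_x divides P in ℤ[X];
-- since cycNum x = Φ_x · cycDen x, this is: cycNum x divides P · cycDen x.
VanishesAtζ : ℕ → Poly → Set
VanishesAtζ x P = Σ Poly (λ H → (P *ₚ cycDen x) ≈ₚ (H *ₚ cycNum x))

-- P(ζ_x) = N
EvalEq : ℕ → Poly → ℤ → Set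
EvalEq x P N = VanishesAtζ x (P +ₚ constₚ (- N))

-- The double sum  Σ_{m=1}^x Σ_{a=1}^x c_q(m-a) S(a,m;r),  expanded as a sum of
-- x-th roots of unity:  c_q(m-a) S(a,m;r)
--   = Σ_{k ≤ q, (k,q)=1} Σ_{l ≤ r, (l,r)=1} e(k(m-a)/q) e((a l + m l*)/r),
-- and for q ∣ x, r ∣ x:  e(k(m-a)/q) e((a l + m l*)/r) = ζ_x^E with
--   E = k (m + x - a) (x/q) + (a l + m l*) (x/r)   (m - a ≡ m + x - a mod q).
-- Each root of unity ζ_x^E is represented by the monomial X^E.

lhsPoly : (x q r : ℕ) .{{_ : NonZero q}} .{{_ : NonZero r}} → Poly
lhsPoly x q r =
  sumₚ (map (λ m →
  sumₚ (map (λ a →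
  sumₚ (map (λ k →
  sumₚ (map (λ l →
    monoₚ (k * (m + x ∸ a) * (x / q) + (a * l + m * inv r l) * (x / r)))
    (filterᵇ (λ l → coprime? l r) (range r))))
    (filterᵇ (λ k → coprime? k q) (range q))))
    (range x)))
    (range x))

rhsValue : (x q r : ℕ) .{{_ : NonZero q}} → ℤ
rhsValue x q r = if does (q ℕ.≟ r) then + (x * x * φ̃ q) else + 0

{-# OPTIONS --safe #-}

-- Let ζ be a primitive x-th root of unity, α = x / q and β = x / r. Expanding c_q and S(·, ·; r), the
-- double sum becomes Σ_{k,l} Σ_{m,a} ζ^(m (k α + l* β) + a (l β − k α)), and each inner sum factors
-- into two sums Σ_{a=1}^{x} ζ^(a c), which are x when x ∣ c and 0 otherwise. The second factor
-- survives only if l β ≡ k α (mod x), which for reduced residues k mod q and l mod r forces q = r and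
-- k = l; the first then survives exactly when k + k* ≡ 0 (mod q).
--
-- The computation takes place in ℤ[X] modulo Φ_x, which Defs gives as the Möbius quotient
-- cycNum x / cycDen x. Writing x = m N with N the product of the primes of x, an induction over these
-- primes builds Φ_N(X^m) as an exact quotient with cycNum x = Φ_N(X^m) · cycDen x; every division is
-- exact because geometric sums 1 + Y + ⋯ + Y^(s−1) for coprime s generate the unit ideal. Hence Φ_x
-- divides X^x − 1 and, for each prime p ∣ x, 1 + X^(x/p) + ⋯ + X^((p−1) x/p), which is all that the
-- evaluation of the sums Σ_a ζ^(a c) needs.

module Submission where

open import Defs
open import Data.Nat using (ℕ; NonZero)

module Polynomial where

  open import Data.Nat using (zero; suc)
  open import Data.Integer as ℤ using (ℤ; +_; -_)
  import Data.Integer.Properties as ℤP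
  open import Data.List using ([]; _∷_; drop)
  open import Data.Product using (_,_)
  open import Relation.Binary.PropositionalEquality using (_≡_; refl; cong; cong₂; sym; trans)
  open import Algebra.Bundles using (CommutativeRing)
  open import Level using (0ℓ)
  open Relation.Binary.PropositionalEquality.≡-Reasoning

  -- Defs' coefficientwise equality _≈ₚ_, as a record so that both sides can be inferred from a proof.
  infix 4 _≈_
  record _≈_ (p q : Poly) : Set where
    constructor mk≈
    field coeff-≡ : ∀ i → coeff p i ≡ coeff q i
  open _≈_ public

  ≈-refl : ∀ {p} → p ≈ p
  ≈-refl = mk≈ λ _ → refl

  ≈-sym : ∀ {p q} → p ≈ q → q ≈ p
  ≈-sym p≈q = mk≈ λ i → sym (coeff-≡ p≈q i)

  ≈-trans : ∀ {p q r} → p ≈ q → q ≈ r → p ≈ r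
  ≈-trans p≈q q≈r = mk≈ λ i → trans (coeff-≡ p≈q i) (coeff-≡ q≈r i)

  ≡⇒≈ : ∀ {p q} → p ≡ q → p ≈ q
  ≡⇒≈ refl = ≈-refl

  ∷-cong : ∀ {a b p q} → a ≡ b → p ≈ q → (a ∷ p) ≈ (b ∷ q)
  ∷-cong a≡b p≈q = mk≈ λ { zero → a≡b ; (suc i) → coeff-≡ p≈q i }

  [0]≈[] : (+ 0 ∷ []) ≈ []
  [0]≈[] = mk≈ λ { zero → refl ; (suc i) → refl }

  coeff-+ₚ : ∀ p q i → coeff (p +ₚ q) i ≡ coeff p i ℤ.+ coeff q i
  coeff-+ₚ []      q       i       = sym (ℤP.+-identityˡ _)
  coeff-+ₚ (a ∷ p) []      i       = sym (ℤP.+-identityʳ _)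
  coeff-+ₚ (a ∷ p) (b ∷ q) zero    = refl
  coeff-+ₚ (a ∷ p) (b ∷ q) (suc i) = coeff-+ₚ p q i

  coeff-scaleₚ : ∀ c p i → coeff (scaleₚ c p) i ≡ c ℤ.* coeff p i
  coeff-scaleₚ c []      i       = sym (ℤP.*-zeroʳ c)
  coeff-scaleₚ c (a ∷ p) zero    = refl
  coeff-scaleₚ c (a ∷ p) (suc i) = coeff-scaleₚ c p i

  coeff-negₚ : ∀ p i → coeff (negₚ p) i ≡ - coeff p i
  coeff-negₚ []      i       = refl
  coeff-negₚ (a ∷ p) zero    = refl
  coeff-negₚ (a ∷ p) (suc i) = coeff-negₚ p i

  coeff-drop : ∀ p i → coeff p (suc i) ≡ coeff (drop 1 p) i
  coeff-drop []      i = refl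
  coeff-drop (a ∷ p) i = refl

  coeff₀-*ₚ : ∀ p q → coeff (p *ₚ q) 0 ≡ coeff p 0 ℤ.* coeff q 0
  coeff₀-*ₚ []      q       = refl
  coeff₀-*ₚ (c ∷ p) []      = sym (ℤP.*-zeroʳ c)
  coeff₀-*ₚ (c ∷ p) (b ∷ q) = ℤP.+-identityʳ _

  coeff-suc-*ₚ : ∀ p q i → coeff (p *ₚ q) (suc i) ≡ coeff p 0 ℤ.* coeff q (suc i) ℤ.+ coeff (drop 1 p *ₚ q) i
  coeff-suc-*ₚ []      q i = refl
  coeff-suc-*ₚ (c ∷ p) q i =
    trans (coeff-+ₚ (scaleₚ c q) (+ 0 ∷ (p *ₚ q)) (suc i)) (cong (ℤ._+ coeff (p *ₚ q) i) (coeff-scaleₚ c q (suc i)))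

  +-cong : ∀ {p p′ q q′} → p ≈ p′ → q ≈ q′ → (p +ₚ q) ≈ (p′ +ₚ q′)
  +-cong {p} {p′} {q} {q′} p≈p′ q≈q′ = mk≈ λ i →
    trans (coeff-+ₚ p q i) (trans (cong₂ ℤ._+_ (coeff-≡ p≈p′ i) (coeff-≡ q≈q′ i)) (sym (coeff-+ₚ p′ q′ i)))

  neg-cong : ∀ {p p′} → p ≈ p′ → negₚ p ≈ negₚ p′
  neg-cong {p} {p′} p≈p′ = mk≈ λ i →
    trans (coeff-negₚ p i) (trans (cong -_ (coeff-≡ p≈p′ i)) (sym (coeff-negₚ p′ i)))

  scale-cong : ∀ c {p p′} → p ≈ p′ → scaleₚ c p ≈ scaleₚ c p′
  scale-cong c {p} {p′} p≈p′ = mk≈ λ i →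
    trans (coeff-scaleₚ c p i) (trans (cong (c ℤ.*_) (coeff-≡ p≈p′ i)) (sym (coeff-scaleₚ c p′ i)))

  +-comm : ∀ p q → (p +ₚ q) ≈ (q +ₚ p)
  +-comm p q = mk≈ λ i →
    trans (coeff-+ₚ p q i) (trans (ℤP.+-comm (coeff p i) (coeff q i)) (sym (coeff-+ₚ q p i)))

  +-assoc : ∀ p q r → ((p +ₚ q) +ₚ r) ≈ (p +ₚ (q +ₚ r))
  +-assoc p q r = mk≈ λ i → begin
    coeff ((p +ₚ q) +ₚ r) i                 ≡⟨ coeff-+ₚ (p +ₚ q) r i ⟩
    coeff (p +ₚ q) i ℤ.+ coeff r i          ≡⟨ cong (ℤ._+ coeff r i) (coeff-+ₚ p q i) ⟩
    coeff p i ℤ.+ coeff q i ℤ.+ coeff r i   ≡⟨ ℤP.+-assoc (coeff p i) (coeff q i) (coeff r i) ⟩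
    coeff p i ℤ.+ (coeff q i ℤ.+ coeff r i) ≡⟨ cong (ℤ._+_ (coeff p i)) (coeff-+ₚ q r i) ⟨
    coeff p i ℤ.+ coeff (q +ₚ r) i          ≡⟨ coeff-+ₚ p (q +ₚ r) i ⟨
    coeff (p +ₚ (q +ₚ r)) i                 ∎

  +-identityʳ : ∀ p → (p +ₚ []) ≈ p
  +-identityʳ p = mk≈ λ i → trans (coeff-+ₚ p [] i) (ℤP.+-identityʳ _)

  +-inverseˡ : ∀ p → (negₚ p +ₚ p) ≈ []
  +-inverseˡ p = mk≈ λ i →
    trans (coeff-+ₚ (negₚ p) p i) (trans (cong (ℤ._+ coeff p i) (coeff-negₚ p i)) (ℤP.+-inverseˡ (coeff p i)))

  +-inverseʳ : ∀ p → (p +ₚ negₚ p) ≈ []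
  +-inverseʳ p = ≈-trans (+-comm p (negₚ p)) (+-inverseˡ p)

  +-interchange : ∀ a b c d → ((a +ₚ b) +ₚ (c +ₚ d)) ≈ ((a +ₚ c) +ₚ (b +ₚ d))
  +-interchange a b c d = mk≈ λ i → begin
    coeff ((a +ₚ b) +ₚ (c +ₚ d)) i                                  ≡⟨ coeff-+ₚ (a +ₚ b) (c +ₚ d) i ⟩
    coeff (a +ₚ b) i ℤ.+ coeff (c +ₚ d) i                           ≡⟨ cong₂ ℤ._+_ (coeff-+ₚ a b i) (coeff-+ₚ c d i) ⟩
    (coeff a i ℤ.+ coeff b i) ℤ.+ (coeff c i ℤ.+ coeff d i)         ≡⟨ interchange (coeff a i) (coeff b i) (coeff c i) (coeff d i) ⟩
    (coeff a i ℤ.+ coeff c i) ℤ.+ (coeff b i ℤ.+ coeff d i)         ≡⟨ cong₂ ℤ._+_ (coeff-+ₚ a c i) (coeff-+ₚ b d i) ⟨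
    coeff (a +ₚ c) i ℤ.+ coeff (b +ₚ d) i                           ≡⟨ coeff-+ₚ (a +ₚ c) (b +ₚ d) i ⟨
    coeff ((a +ₚ c) +ₚ (b +ₚ d)) i                                  ∎
    where open import Algebra.Properties.CommutativeSemigroup ℤP.+-commutativeSemigroup using (interchange)

  scale-+ : ∀ c p q → scaleₚ c (p +ₚ q) ≈ (scaleₚ c p +ₚ scaleₚ c q)
  scale-+ c p q = mk≈ λ i → begin
    coeff (scaleₚ c (p +ₚ q)) i                       ≡⟨ coeff-scaleₚ c (p +ₚ q) i ⟩
    c ℤ.* coeff (p +ₚ q) i                            ≡⟨ cong (c ℤ.*_) (coeff-+ₚ p q i) ⟩
    c ℤ.* (coeff p i ℤ.+ coeff q i)                   ≡⟨ ℤP.*-distribˡ-+ c (coeff p i) (coeff q i) ⟩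
    c ℤ.* coeff p i ℤ.+ c ℤ.* coeff q i               ≡⟨ cong₂ ℤ._+_ (coeff-scaleₚ c p i) (coeff-scaleₚ c q i) ⟨
    coeff (scaleₚ c p) i ℤ.+ coeff (scaleₚ c q) i     ≡⟨ coeff-+ₚ (scaleₚ c p) (scaleₚ c q) i ⟨
    coeff (scaleₚ c p +ₚ scaleₚ c q) i                ∎

  +-scale : ∀ a b p → scaleₚ (a ℤ.+ b) p ≈ (scaleₚ a p +ₚ scaleₚ b p)
  +-scale a b p = mk≈ λ i → begin
    coeff (scaleₚ (a ℤ.+ b) p) i                      ≡⟨ coeff-scaleₚ (a ℤ.+ b) p i ⟩
    (a ℤ.+ b) ℤ.* coeff p i                           ≡⟨ ℤP.*-distribʳ-+ (coeff p i) a b ⟩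
    a ℤ.* coeff p i ℤ.+ b ℤ.* coeff p i               ≡⟨ cong₂ ℤ._+_ (coeff-scaleₚ a p i) (coeff-scaleₚ b p i) ⟨
    coeff (scaleₚ a p) i ℤ.+ coeff (scaleₚ b p) i     ≡⟨ coeff-+ₚ (scaleₚ a p) (scaleₚ b p) i ⟨
    coeff (scaleₚ a p +ₚ scaleₚ b p) i                ∎

  scale-scale : ∀ a b p → scaleₚ a (scaleₚ b p) ≈ scaleₚ (a ℤ.* b) p
  scale-scale a b p = mk≈ λ i → begin
    coeff (scaleₚ a (scaleₚ b p)) i   ≡⟨ coeff-scaleₚ a (scaleₚ b p) i ⟩
    a ℤ.* coeff (scaleₚ b p) i        ≡⟨ cong (a ℤ.*_) (coeff-scaleₚ b p i) ⟩
    a ℤ.* (b ℤ.* coeff p i)           ≡⟨ ℤP.*-assoc a b (coeff p i) ⟨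
    a ℤ.* b ℤ.* coeff p i             ≡⟨ coeff-scaleₚ (a ℤ.* b) p i ⟨
    coeff (scaleₚ (a ℤ.* b) p) i      ∎

  scale-0 : ∀ p → scaleₚ (+ 0) p ≈ []
  scale-0 p = mk≈ (coeff-scaleₚ (+ 0) p)

  scale-1 : ∀ p → scaleₚ (+ 1) p ≈ p
  scale-1 p = mk≈ λ i → trans (coeff-scaleₚ (+ 1) p i) (ℤP.*-identityˡ _)

  *-congˡ-coeff : ∀ {p p′} q → (∀ i → coeff p i ≡ coeff p′ i) → ∀ i → coeff (p *ₚ q) i ≡ coeff (p′ *ₚ q) i
  *-congˡ-coeff {p} {p′} q p≡p′ zero = begin
    coeff (p *ₚ q) 0             ≡⟨ coeff₀-*ₚ p q ⟩
    coeff p 0 ℤ.* coeff q 0      ≡⟨ cong (ℤ._* coeff q 0) (p≡p′ 0) ⟩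
    coeff p′ 0 ℤ.* coeff q 0     ≡⟨ coeff₀-*ₚ p′ q ⟨
    coeff (p′ *ₚ q) 0            ∎
  *-congˡ-coeff {p} {p′} q p≡p′ (suc i) = begin
    coeff (p *ₚ q) (suc i)                                        ≡⟨ coeff-suc-*ₚ p q i ⟩
    coeff p 0 ℤ.* coeff q (suc i) ℤ.+ coeff (drop 1 p *ₚ q) i     ≡⟨ cong₂ ℤ._+_ (cong (ℤ._* coeff q (suc i)) (p≡p′ 0)) tail-≡ ⟩
    coeff p′ 0 ℤ.* coeff q (suc i) ℤ.+ coeff (drop 1 p′ *ₚ q) i   ≡⟨ coeff-suc-*ₚ p′ q i ⟨
    coeff (p′ *ₚ q) (suc i)                                       ∎
    where
    tail-≡ : coeff (drop 1 p *ₚ q) i ≡ coeff (drop 1 p′ *ₚ q) i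
    tail-≡ = *-congˡ-coeff {drop 1 p} {drop 1 p′} q (λ j → trans (sym (coeff-drop p j)) (trans (p≡p′ (suc j)) (coeff-drop p′ j))) i

  *-congʳ : ∀ p {q q′} → q ≈ q′ → (p *ₚ q) ≈ (p *ₚ q′)
  *-congʳ []      q≈q′ = ≈-refl
  *-congʳ (c ∷ p) q≈q′ = +-cong (scale-cong c q≈q′) (∷-cong refl (*-congʳ p q≈q′))

  *-cong : ∀ {p p′ q q′} → p ≈ p′ → q ≈ q′ → (p *ₚ q) ≈ (p′ *ₚ q′)
  *-cong {p} {p′} {q} p≈p′ q≈q′ = ≈-trans (mk≈ (*-congˡ-coeff {p} {p′} q (coeff-≡ p≈p′))) (*-congʳ p′ q≈q′)

  *-zeroʳ : ∀ p → (p *ₚ []) ≈ []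
  *-zeroʳ []      = ≈-refl
  *-zeroʳ (c ∷ p) = ≈-trans (∷-cong refl (*-zeroʳ p)) [0]≈[]

  0∷-* : ∀ p q → ((+ 0 ∷ p) *ₚ q) ≈ (+ 0 ∷ (p *ₚ q))
  0∷-* p q = +-cong (scale-0 q) ≈-refl

  *-distribˡ-+ : ∀ p q r → (p *ₚ (q +ₚ r)) ≈ ((p *ₚ q) +ₚ (p *ₚ r))
  *-distribˡ-+ []      q r = ≈-refl
  *-distribˡ-+ (c ∷ p) q r = ≈-trans (+-cong (scale-+ c q r) (∷-cong refl (*-distribˡ-+ p q r)))
    (+-interchange (scaleₚ c q) (scaleₚ c r) (+ 0 ∷ (p *ₚ q)) (+ 0 ∷ (p *ₚ r)))

  *-distribʳ-+ : ∀ r p q → ((p +ₚ q) *ₚ r) ≈ ((p *ₚ r) +ₚ (q *ₚ r))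
  *-distribʳ-+ r []      q       = ≈-refl
  *-distribʳ-+ r (a ∷ p) []      = ≈-sym (+-identityʳ _)
  *-distribʳ-+ r (a ∷ p) (b ∷ q) = ≈-trans (+-cong (+-scale a b r) (∷-cong refl (*-distribʳ-+ r p q)))
    (+-interchange (scaleₚ a r) (scaleₚ b r) (+ 0 ∷ (p *ₚ r)) (+ 0 ∷ (q *ₚ r)))

  scale-*ˡ : ∀ c p q → (scaleₚ c p *ₚ q) ≈ scaleₚ c (p *ₚ q)
  scale-*ˡ c []      q = ≈-refl
  scale-*ˡ c (a ∷ p) q = ≈-trans (+-cong (≈-sym (scale-scale c a q)) (∷-cong (sym (ℤP.*-zeroʳ c)) (scale-*ˡ c p q)))
    (≈-sym (scale-+ c (scaleₚ a q) (+ 0 ∷ (p *ₚ q))))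

  *-assoc : ∀ p q r → ((p *ₚ q) *ₚ r) ≈ (p *ₚ (q *ₚ r))
  *-assoc []      q r = ≈-refl
  *-assoc (a ∷ p) q r = ≈-trans (*-distribʳ-+ r (scaleₚ a q) (+ 0 ∷ (p *ₚ q)))
    (+-cong (scale-*ˡ a q r) (≈-trans (0∷-* (p *ₚ q) r) (∷-cong refl (*-assoc p q r))))

  +-swapₗ : ∀ a b c → (a +ₚ (b +ₚ c)) ≈ (b +ₚ (a +ₚ c))
  +-swapₗ a b c = ≈-trans (≈-sym (+-assoc a b c)) (≈-trans (+-cong (+-comm a b) ≈-refl) (+-assoc b a c))

  *-∷ʳ : ∀ p b q → (p *ₚ (b ∷ q)) ≈ (scaleₚ b p +ₚ (+ 0 ∷ (p *ₚ q)))
  *-∷ʳ []      b q = ≈-sym [0]≈[]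
  *-∷ʳ (a ∷ p) b q = ∷-cong (trans (ℤP.+-identityʳ _) (trans (ℤP.*-comm a b) (sym (ℤP.+-identityʳ _))))
    (≈-trans (+-cong ≈-refl (*-∷ʳ p b q)) (+-swapₗ (scaleₚ a q) (scaleₚ b p) (+ 0 ∷ (p *ₚ q))))

  *-comm : ∀ p q → (p *ₚ q) ≈ (q *ₚ p)
  *-comm []      q = ≈-sym (*-zeroʳ q)
  *-comm (a ∷ p) q = ≈-trans (+-cong ≈-refl (∷-cong refl (*-comm p q))) (≈-sym (*-∷ʳ q a p))

  *-identityˡ : ∀ p → (constₚ (+ 1) *ₚ p) ≈ p
  *-identityˡ p = ≈-trans (+-cong (scale-1 p) [0]≈[]) (+-identityʳ p)

  *-identityʳ : ∀ p → (p *ₚ constₚ (+ 1)) ≈ p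
  *-identityʳ p = ≈-trans (*-comm p _) (*-identityˡ p)

  ℤ[X] : CommutativeRing 0ℓ 0ℓ
  ℤ[X] = record
    { Carrier = Poly
    ; _≈_ = _≈_
    ; _+_ = _+ₚ_
    ; _*_ = _*ₚ_
    ; -_ = negₚ
    ; 0# = []
    ; 1# = constₚ (+ 1)
    ; isCommutativeRing = record
      { isRing = record
        { +-isAbelianGroup = record
          { isGroup = record
            { isMonoid = record
              { isSemigroup = record
                { isMagma = record
                  { isEquivalence = record { refl = ≈-refl ; sym = ≈-sym ; trans = ≈-trans }
                  ; ∙-cong = +-cong }
                ; assoc = +-assoc }
              ; identity = (λ _ → ≈-refl) , +-identityʳ }
            ; inverse = +-inverseˡ , +-inverseʳ
            ; ⁻¹-cong = neg-cong }
          ; comm = +-comm }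
        ; *-cong = *-cong
        ; *-assoc = *-assoc
        ; *-identity = *-identityˡ , *-identityʳ
        ; distrib = *-distribˡ-+ , *-distribʳ-+ }
      ; *-comm = *-comm }
    }

module PolynomialRing where

  open import Data.Nat as ℕ using (zero; suc)
  open import Data.Integer as ℤ using (ℤ; +_)
  import Data.Integer.Properties as ℤP
  open import Data.Maybe using (Maybe; just; nothing)
  open import Relation.Nullary using (yes; no)
  open import Relation.Binary.PropositionalEquality as ≡ using (refl)
  open import Algebra.Bundles using (CommutativeRing)
  open import Algebra.Solver.Ring.AlmostCommutativeRing using (fromCommutativeRing; _-Raw-AlmostCommutative⟶_)
  import Algebra.Solver.Ring

  open Polynomial public using (_≈_; mk≈; coeff-≡; ≡⇒≈; ≈-refl; ≈-sym; ≈-trans; ℤ[X])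
  open CommutativeRing ℤ[X] public hiding (_≈_; refl; sym; trans; reflexive)

  constₚ-homomorphism : CommutativeRing.rawRing ℤP.+-*-commutativeRing -Raw-AlmostCommutative⟶ fromCommutativeRing ℤ[X]
  constₚ-homomorphism = record
    { ⟦_⟧    = constₚ
    ; +-homo = λ _ _ → ≈-refl
    ; *-homo = λ _ _ → mk≈ λ { zero → ≡.sym (ℤP.+-identityʳ _) ; (suc i) → refl }
    ; -‿homo = λ _ → ≈-refl
    ; 0-homo = Polynomial.[0]≈[]
    ; 1-homo = ≈-refl
    }

  constₚ-≟ : ∀ a b → Maybe (constₚ a ≈ constₚ b)
  constₚ-≟ a b with a ℤ.≟ b
  ... | yes refl = just ≈-refl
  ... | no _     = nothing

  module Solver = Algebra.Solver.Ring (CommutativeRing.rawRing ℤP.+-*-commutativeRing) (fromCommutativeRing ℤ[X])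
    constₚ-homomorphism constₚ-≟
  open Solver public using (solve; _:=_; _:+_; _:*_; :-_; _:-_; con)

  infixl 6 _+ₗ_ _+ᵣ_
  infixl 7 _*ₗ_ _*ᵣ_

  _+ₗ_ : ∀ c {a b} → a ≈ b → c + a ≈ c + b
  c +ₗ a≈b = +-cong (≈-refl {c}) a≈b

  _+ᵣ_ : ∀ {a b} → a ≈ b → ∀ c → a + c ≈ b + c
  a≈b +ᵣ c = +-cong a≈b (≈-refl {c})

  _*ₗ_ : ∀ c {a b} → a ≈ b → c * a ≈ c * b
  c *ₗ a≈b = *-cong (≈-refl {c}) a≈b

  _*ᵣ_ : ∀ {a b} → a ≈ b → ∀ c → a * c ≈ b * c
  a≈b *ᵣ c = *-cong a≈b (≈-refl {c})

  open import Algebra.Properties.CommutativeSemigroup.Divisibility *-commutativeSemigroup public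
  open import Algebra.Properties.Monoid.Divisibility *-monoid public using (∣ʳ-refl; ∣ʳ-reflexive)

module SumsAndProducts where

  open import Data.Nat as ℕ using (ℕ; zero; suc)
  open import Data.Nat.ListAction using () renaming (sum to sumℕ)
  open import Data.Integer using (+_)
  import Data.Integer.Properties as ℤP
  open import Data.List using (List; []; _∷_; map; length; _++_)
  open import Data.List.Relation.Binary.Permutation.Propositional using (_↭_; refl; prep; swap; trans)
  open import Relation.Binary.PropositionalEquality as ≡ using (refl)

  open PolynomialRing
  open import Algebra.Properties.CommutativeSemigroup +-commutativeSemigroup using (interchange)
  open import Algebra.Properties.CommutativeSemigroup *-commutativeSemigroup using (x∙yz≈y∙xz)

  module _ {A : Set} where

    sumₚ-cong : ∀ {f g : A → Poly} xs → (∀ a → f a ≈ g a) → sumₚ (map f xs) ≈ sumₚ (map g xs)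
    sumₚ-cong []       f≈g = ≈-refl
    sumₚ-cong (x ∷ xs) f≈g = +-cong (f≈g x) (sumₚ-cong xs f≈g)

    sumₚ-+ : ∀ (f g : A → Poly) xs → sumₚ (map (λ a → f a + g a) xs) ≈ sumₚ (map f xs) + sumₚ (map g xs)
    sumₚ-+ f g []       = ≈-sym (+-identityˡ 0#)
    sumₚ-+ f g (x ∷ xs) = ≈-trans ((f x + g x) +ₗ sumₚ-+ f g xs) (interchange (f x) (g x) _ _)

    sumₚ-*ˡ : ∀ c (f : A → Poly) xs → sumₚ (map (λ a → c * f a) xs) ≈ c * sumₚ (map f xs)
    sumₚ-*ˡ c f []       = ≈-sym (zeroʳ c)
    sumₚ-*ˡ c f (x ∷ xs) = ≈-trans ((c * f x) +ₗ sumₚ-*ˡ c f xs) (≈-sym (distribˡ c (f x) _))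

    sumₚ-*ʳ : ∀ c (f : A → Poly) xs → sumₚ (map (λ a → f a * c) xs) ≈ sumₚ (map f xs) * c
    sumₚ-*ʳ c f xs = ≈-trans (sumₚ-cong xs (λ a → *-comm (f a) c)) (≈-trans (sumₚ-*ˡ c f xs) (*-comm c _))

    sumₚ-const : ∀ (f : A → ℕ) xs → sumₚ (map (λ a → constₚ (+ f a)) xs) ≈ constₚ (+ sumℕ (map f xs))
    sumₚ-const f []       = ≈-sym Polynomial.[0]≈[]
    sumₚ-const f (x ∷ xs) = constₚ (+ f x) +ₗ sumₚ-const f xs

  constₚ-*-constₚ : ∀ a b → constₚ (+ a) * constₚ (+ b) ≈ constₚ (+ (a ℕ.* b))
  constₚ-*-constₚ a b = mk≈ λ where
    zero          → ≡.trans (ℤP.+-identityʳ _) (≡.sym (ℤP.pos-* a b))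
    (suc zero)    → refl
    (suc (suc i)) → refl

  sumₚ-comm : ∀ {A B : Set} (f : A → B → Poly) xs ys →
              sumₚ (map (λ a → sumₚ (map (f a) ys)) xs) ≈ sumₚ (map (λ b → sumₚ (map (λ a → f a b) xs)) ys)
  sumₚ-comm f []       ys = ≈-sym (sumₚ-zero ys)
    where
    sumₚ-zero : ∀ ys → sumₚ (map (λ _ → 0#) ys) ≈ 0#
    sumₚ-zero []       = ≈-refl
    sumₚ-zero (_ ∷ ys) = sumₚ-zero ys
  sumₚ-comm f (x ∷ xs) ys = ≈-trans (sumₚ (map (f x) ys) +ₗ sumₚ-comm f xs ys)
    (≈-sym (sumₚ-+ (f x) (λ b → sumₚ (map (λ a → f a b) xs)) ys))

  sumₚ-*-sumₚ : ∀ {A B : Set} (f : A → Poly) (g : B → Poly) xs ys →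
                sumₚ (map (λ a → sumₚ (map (λ b → f a * g b) ys)) xs) ≈ sumₚ (map f xs) * sumₚ (map g ys)
  sumₚ-*-sumₚ f g xs ys =
    ≈-trans (sumₚ-cong xs (λ a → sumₚ-*ˡ (f a) g ys)) (sumₚ-*ʳ (sumₚ (map g ys)) f xs)

  prodₚ-map-++ : ∀ (f : ℕ → Poly) xs ys → prodₚ (map f (xs ++ ys)) ≈ prodₚ (map f xs) * prodₚ (map f ys)
  prodₚ-map-++ f []       ys = ≈-sym (*-identityˡ _)
  prodₚ-map-++ f (x ∷ xs) ys = ≈-trans (f x *ₗ prodₚ-map-++ f xs ys) (≈-sym (*-assoc (f x) _ _))

  prodₚ-map-↭ : ∀ (f : ℕ → Poly) {xs ys} → xs ↭ ys → prodₚ (map f xs) ≈ prodₚ (map f ys)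
  prodₚ-map-↭ f refl           = ≈-refl
  prodₚ-map-↭ f (prep x xs↭ys) = f x *ₗ prodₚ-map-↭ f xs↭ys
  prodₚ-map-↭ f (swap x y xs↭ys) = ≈-trans (x∙yz≈y∙xz (f x) (f y) _) (f y *ₗ (f x *ₗ prodₚ-map-↭ f xs↭ys))
  prodₚ-map-↭ f (trans xs↭ys ys↭zs) = ≈-trans (prodₚ-map-↭ f xs↭ys) (prodₚ-map-↭ f ys↭zs)

  sumₚ-ones : ∀ {A : Set} (xs : List A) → sumₚ (map (λ _ → 1#) xs) ≈ constₚ (+ length xs)
  sumₚ-ones []       = ≈-sym Polynomial.[0]≈[]
  sumₚ-ones (_ ∷ xs) = 1# +ₗ sumₚ-ones xs

module GeometricSums where

  open import Data.Nat as ℕ using (ℕ; zero; suc)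
  import Data.Nat.Properties as ℕP
  open import Data.Nat.GCD using (module Bézout)
  open import Data.Nat.Coprimality using (Coprime; coprime-Bézout)
  open import Data.Integer as ℤ using (+_)
  import Data.Integer.Properties as ℤP
  open import Data.Product using (∃₂; _,_)
  open import Data.List using (applyUpTo)
  open import Function using (_∘_)
  open import Relation.Binary.PropositionalEquality as ≡ using (_≡_; refl; cong)

  open PolynomialRing
  open Polynomial using (∷-cong; 0∷-*)
  open import Relation.Binary.Reasoning.Setoid setoid

  infix 8 X^_

  X^_ : ℕ → Poly
  X^_ = monoₚ

  Xⁿ−1 : ℕ → Poly
  Xⁿ−1 n = X^ n - 1#

  X^-+ : ∀ a b → X^ (a ℕ.+ b) ≈ X^ a * X^ b
  X^-+ zero    b = ≈-sym (*-identityˡ (X^ b))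
  X^-+ (suc a) b = ≈-trans (∷-cong refl (X^-+ a b)) (≈-sym (0∷-* (X^ a) (X^ b)))

  X^-cong : ∀ {a b} → a ≡ b → X^ a ≈ X^ b
  X^-cong refl = ≈-refl

  geomSum : ℕ → ℕ → Poly
  geomSum w zero    = 0#
  geomSum w (suc n) = 1# + X^ w * geomSum w n

  geomSum-*-Xⁿ−1 : ∀ w n → geomSum w n * Xⁿ−1 w ≈ Xⁿ−1 (n ℕ.* w)
  geomSum-*-Xⁿ−1 w zero    = ≈-trans (zeroˡ (Xⁿ−1 w)) (≈-sym (-‿inverseʳ 1#))
  geomSum-*-Xⁿ−1 w (suc n) = begin
    (1# + X^ w * geomSum w n) * Xⁿ−1 w
      ≈⟨ solve 3 (λ a g c → (con (+ 1) :+ a :* g) :* c := c :+ a :* (g :* c)) ≈-refl (X^ w) (geomSum w n) (Xⁿ−1 w) ⟩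
    Xⁿ−1 w + X^ w * (geomSum w n * Xⁿ−1 w)  ≈⟨ Xⁿ−1 w +ₗ X^ w *ₗ geomSum-*-Xⁿ−1 w n ⟩
    Xⁿ−1 w + X^ w * Xⁿ−1 (n ℕ.* w)
      ≈⟨ solve 2 (λ a b → (a :- con (+ 1)) :+ a :* (b :- con (+ 1)) := a :* b :- con (+ 1)) ≈-refl (X^ w) (X^ (n ℕ.* w)) ⟩
    X^ w * X^ (n ℕ.* w) - 1#                   ≈⟨ X^-+ w (n ℕ.* w) +ᵣ - 1# ⟨
    Xⁿ−1 (suc n ℕ.* w)                        ∎

  geomSum-+ : ∀ w a b → geomSum w (a ℕ.+ b) ≈ geomSum w a + X^ (a ℕ.* w) * geomSum w b
  geomSum-+ w zero    b = ≈-sym (*-identityˡ (geomSum w b))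
  geomSum-+ w (suc a) b = begin
    1# + X^ w * geomSum w (a ℕ.+ b)                              ≈⟨ 1# +ₗ X^ w *ₗ geomSum-+ w a b ⟩
    1# + X^ w * (geomSum w a + X^ (a ℕ.* w) * geomSum w b)
      ≈⟨ solve 4 (λ u g v h → con (+ 1) :+ u :* (g :+ v :* h) := (con (+ 1) :+ u :* g) :+ (u :* v) :* h) ≈-refl
           (X^ w) (geomSum w a) (X^ (a ℕ.* w)) (geomSum w b) ⟩
    geomSum w (suc a) + (X^ w * X^ (a ℕ.* w)) * geomSum w b      ≈⟨ geomSum w (suc a) +ₗ X^-+ w (a ℕ.* w) *ᵣ geomSum w b ⟨
    geomSum w (suc a) + X^ (suc a ℕ.* w) * geomSum w b           ∎

  geomSum-* : ∀ w a b → geomSum w (b ℕ.* a) ≈ geomSum w a * geomSum (a ℕ.* w) b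
  geomSum-* w a zero    = ≈-sym (zeroʳ (geomSum w a))
  geomSum-* w a (suc b) = begin
    geomSum w (a ℕ.+ b ℕ.* a)                                        ≈⟨ geomSum-+ w a (b ℕ.* a) ⟩
    geomSum w a + X^ (a ℕ.* w) * geomSum w (b ℕ.* a)                 ≈⟨ geomSum w a +ₗ X^ (a ℕ.* w) *ₗ geomSum-* w a b ⟩
    geomSum w a + X^ (a ℕ.* w) * (geomSum w a * geomSum (a ℕ.* w) b)
      ≈⟨ solve 3 (λ g u h → g :+ u :* (g :* h) := g :* (con (+ 1) :+ u :* h)) ≈-refl
           (geomSum w a) (X^ (a ℕ.* w)) (geomSum (a ℕ.* w) b) ⟩
    geomSum w a * geomSum (a ℕ.* w) (suc b)                          ∎

  geomSum-1 : ∀ w → geomSum w 1 ≈ 1#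
  geomSum-1 w = ≈-trans (1# +ₗ zeroʳ (X^ w)) (+-identityʳ 1#)

  sumₚ-geometric : ∀ c (f : ℕ → Poly) → (∀ i → f (suc i) ≈ X^ c * f i) → ∀ n → sumₚ (applyUpTo f n) ≈ f 0 * geomSum c n
  sumₚ-geometric c f f[1+i]≈Xᶜfi zero    = ≈-sym (zeroʳ (f 0))
  sumₚ-geometric c f f[1+i]≈Xᶜfi (suc n) = begin
    f 0 + sumₚ (applyUpTo (f ∘ suc) n)    ≈⟨ f 0 +ₗ sumₚ-geometric c (f ∘ suc) (f[1+i]≈Xᶜfi ∘ suc) n ⟩
    f 0 + f 1 * geomSum c n               ≈⟨ f 0 +ₗ f[1+i]≈Xᶜfi 0 *ᵣ geomSum c n ⟩
    f 0 + X^ c * f 0 * geomSum c n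
      ≈⟨ solve 3 (λ a y g → a :+ y :* a :* g := a :* (con (+ 1) :+ y :* g)) ≈-refl (f 0) (X^ c) (geomSum c n) ⟩
    f 0 * geomSum c (suc n)               ∎

  Comaximal : Poly → Poly → Set
  Comaximal a b = ∃₂ λ u v → u * a + v * b ≈ 1#

  comaximal-∣ : ∀ {a b a′ b′} → Comaximal a b → a′ ∣ a → b′ ∣ b → Comaximal a′ b′
  comaximal-∣ {a′ = a′} {b′} (u , v , ua+vb≈1) (c , ca′≈a) (d , db′≈b) = u * c , v * d , (begin
    u * c * a′ + v * d * b′      ≈⟨ +-cong (*-assoc u c a′) (*-assoc v d b′) ⟩
    u * (c * a′) + v * (d * b′)  ≈⟨ +-cong (u *ₗ ca′≈a) (v *ₗ db′≈b) ⟩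
    u * _ + v * _                ≈⟨ ua+vb≈1 ⟩
    1#                           ∎)

  -- From d + y b = x a:  geomSum w (x a) = geomSum w d + X^(d w) geomSum w (y b), and the two
  -- outer sums are multiples of geomSum w a and geomSum w b respectively.
  geomSum-combination : ∀ w {d a b x y} → d ℕ.+ y ℕ.* b ≡ x ℕ.* a →
                        ∃₂ λ u v → u * geomSum w a + v * geomSum w b ≈ geomSum w d
  geomSum-combination w {d} {a} {b} {x} {y} eq = geomSum (a ℕ.* w) x , - (X^ (d ℕ.* w) * geomSum (b ℕ.* w) y) , ≈-sym (begin
    geomSum w d
      ≈⟨ solve 2 (λ g h → g := (g :+ h) :- h) ≈-refl (geomSum w d) (X^ (d ℕ.* w) * geomSum w (y ℕ.* b)) ⟩
    (geomSum w d + X^ (d ℕ.* w) * geomSum w (y ℕ.* b)) - X^ (d ℕ.* w) * geomSum w (y ℕ.* b)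
      ≈⟨ geomSum-+ w d (y ℕ.* b) +ᵣ - (X^ (d ℕ.* w) * geomSum w (y ℕ.* b)) ⟨
    geomSum w (d ℕ.+ y ℕ.* b) - X^ (d ℕ.* w) * geomSum w (y ℕ.* b)
      ≈⟨ +-cong (≡⇒≈ (cong (geomSum w) eq)) (-‿cong (X^ (d ℕ.* w) *ₗ geomSum-* w b y)) ⟩
    geomSum w (x ℕ.* a) - X^ (d ℕ.* w) * (geomSum w b * geomSum (b ℕ.* w) y)
      ≈⟨ geomSum-* w a x +ᵣ - (X^ (d ℕ.* w) * (geomSum w b * geomSum (b ℕ.* w) y)) ⟩
    geomSum w a * geomSum (a ℕ.* w) x - X^ (d ℕ.* w) * (geomSum w b * geomSum (b ℕ.* w) y)
      ≈⟨ solve 5 (λ A U B V Z → A :* U :- Z :* (B :* V) := U :* A :+ (:- (Z :* V)) :* B) ≈-refl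
           (geomSum w a) (geomSum (a ℕ.* w) x) (geomSum w b) (geomSum (b ℕ.* w) y) (X^ (d ℕ.* w)) ⟩
    geomSum (a ℕ.* w) x * geomSum w a + - (X^ (d ℕ.* w) * geomSum (b ℕ.* w) y) * geomSum w b ∎)

  geomSum-bézout : ∀ w {d a b} → Bézout.Identity d a b → ∃₂ λ u v → u * geomSum w a + v * geomSum w b ≈ geomSum w d
  geomSum-bézout w (Bézout.+- x y eq) = geomSum-combination w {x = x} {y} eq
  geomSum-bézout w {a = a} {b} (Bézout.-+ x y eq) =
    let u , v , vb+ua≈g = geomSum-combination w {x = y} {x} eq
    in  v , u , ≈-trans (+-comm (v * geomSum w a) (u * geomSum w b)) vb+ua≈g

  geomSum-comaximal : ∀ w {a b} → Coprime a b → Comaximal (geomSum w a) (geomSum w b)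
  geomSum-comaximal w a⊥b =
    let u , v , e = geomSum-bézout w (coprime-Bézout a⊥b) in u , v , ≈-trans e (geomSum-1 w)

module Cancellation where

  open import Data.Nat as ℕ using (zero; suc; NonZero)
  open import Data.Integer as ℤ using (ℤ; +_; -[1+_])
  import Data.Integer.Properties as ℤP
  open import Data.List using (drop)
  open import Data.Product using (_,_)
  open import Data.Sum using (inj₁; inj₂)
  open import Relation.Nullary using (contradiction)
  open import Relation.Binary.PropositionalEquality as ≡ using (_≡_; _≢_; cong)

  open PolynomialRing
  open Polynomial using (coeff₀-*ₚ; coeff-suc-*ₚ; coeff-drop)
  open GeometricSums using (Xⁿ−1)

  ∣Xⁿ−1⇒coeff₀≢0 : ∀ n .{{_ : NonZero n}} {E} → E ∣ Xⁿ−1 n → coeff E 0 ≢ + 0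
  ∣Xⁿ−1⇒coeff₀≢0 (suc n) {E} (q , qE≈Xⁿ−1) E₀≡0 = contradiction 0≡-1 λ ()
    where
    0≡-1 : + 0 ≡ -[1+ 0 ]
    0≡-1 = begin
      + 0                      ≡⟨ ℤP.*-zeroʳ (coeff q 0) ⟨
      coeff q 0 ℤ.* + 0        ≡⟨ cong (coeff q 0 ℤ.*_) E₀≡0 ⟨
      coeff q 0 ℤ.* coeff E 0  ≡⟨ coeff₀-*ₚ q E ⟨
      coeff (q * E) 0          ≡⟨ coeff-≡ qE≈Xⁿ−1 0 ⟩
      -[1+ 0 ]                 ∎
      where open ≡.≡-Reasoning

  *≈0⇒coeff≡0 : ∀ {E} → coeff E 0 ≢ + 0 → ∀ F i → F * E ≈ 0# → coeff F i ≡ + 0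
  *≈0⇒coeff≡0 {E} E₀≢0 F zero FE≈0 with ℤP.i*j≡0⇒i≡0∨j≡0 (coeff F 0) (≡.trans (≡.sym (coeff₀-*ₚ F E)) (coeff-≡ FE≈0 0))
  ... | inj₁ F₀≡0 = F₀≡0
  ... | inj₂ E₀≡0 = contradiction E₀≡0 E₀≢0
  *≈0⇒coeff≡0 {E} E₀≢0 F (suc i) FE≈0 =
    ≡.trans (coeff-drop F i) (*≈0⇒coeff≡0 E₀≢0 (drop 1 F) i (mk≈ tail-≡0))
    where
    open ≡.≡-Reasoning
    tail-≡0 : ∀ k → coeff (drop 1 F * E) k ≡ + 0
    tail-≡0 k = begin
      coeff (drop 1 F * E) k                                       ≡⟨ ℤP.+-identityˡ _ ⟨
      + 0 ℤ.* coeff E (suc k) ℤ.+ coeff (drop 1 F * E) k           ≡⟨ cong (λ c → c ℤ.* coeff E (suc k) ℤ.+ coeff (drop 1 F * E) k)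
                                                                             (*≈0⇒coeff≡0 E₀≢0 F 0 FE≈0) ⟨
      coeff F 0 ℤ.* coeff E (suc k) ℤ.+ coeff (drop 1 F * E) k     ≡⟨ coeff-suc-*ₚ F E k ⟨
      coeff (F * E) (suc k)                                        ≡⟨ coeff-≡ FE≈0 (suc k) ⟩
      + 0                                                          ∎

  *-cancelˡ-≈ : ∀ E {F G} → coeff E 0 ≢ + 0 → E * F ≈ E * G → F ≈ G
  *-cancelˡ-≈ E {F} {G} E₀≢0 EF≈EG = begin
    F            ≈⟨ solve 2 (λ f g → f := (f :- g) :+ g) ≈-refl F G ⟩
    (F - G) + G  ≈⟨ mk≈ (λ i → *≈0⇒coeff≡0 E₀≢0 (F - G) i [F-G]E≈0) +ᵣ G ⟩
    0# + G       ≈⟨ +-identityˡ G ⟩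
    G            ∎
    where
    open import Relation.Binary.Reasoning.Setoid setoid
    [F-G]E≈0 : (F - G) * E ≈ 0#
    [F-G]E≈0 = begin
      (F - G) * E    ≈⟨ solve 3 (λ e f g → (f :- g) :* e := e :* f :- e :* g) ≈-refl E F G ⟩
      E * F - E * G  ≈⟨ EF≈EG +ᵣ - (E * G) ⟩
      E * G - E * G  ≈⟨ -‿inverseʳ (E * G) ⟩
      0#             ∎

module GeometricSumDivisibility where

  open import Data.Nat as ℕ using (ℕ; NonZero)
  import Data.Nat.Properties as ℕP
  open import Data.Nat.GCD using (gcd; gcd-GCD; module Bézout)
  open import Data.Integer using (+_)
  open import Data.Product using (∃₂; _,_)
  open import Relation.Binary.PropositionalEquality as ≡ using (_≡_; cong)

  open PolynomialRing
  open GeometricSums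
  open Cancellation
  open import Relation.Binary.Reasoning.Setoid setoid

  Xⁿ−1≈geomSum*X−1 : ∀ n → Xⁿ−1 n ≈ geomSum 1 n * Xⁿ−1 1
  Xⁿ−1≈geomSum*X−1 n = ≈-sym (≈-trans (geomSum-*-Xⁿ−1 1 n) (≡⇒≈ (cong Xⁿ−1 (ℕP.*-identityʳ n))))

  Xⁿ−1-bézout : ∀ a b → ∃₂ λ u v → u * Xⁿ−1 a + v * Xⁿ−1 b ≈ Xⁿ−1 (gcd a b)
  Xⁿ−1-bézout a b =
    let u , v , e = geomSum-bézout 1 (Bézout.identity (gcd-GCD a b)) in
    u , v , (begin
      u * Xⁿ−1 a + v * Xⁿ−1 b
        ≈⟨ +-cong (u *ₗ Xⁿ−1≈geomSum*X−1 a) (v *ₗ Xⁿ−1≈geomSum*X−1 b) ⟩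
      u * (geomSum 1 a * Xⁿ−1 1) + v * (geomSum 1 b * Xⁿ−1 1)
        ≈⟨ solve 5 (λ u A v B y → u :* (A :* y) :+ v :* (B :* y) := (u :* A :+ v :* B) :* y) ≈-refl
             u (geomSum 1 a) v (geomSum 1 b) (Xⁿ−1 1) ⟩
      (u * geomSum 1 a + v * geomSum 1 b) * Xⁿ−1 1
        ≈⟨ e *ᵣ Xⁿ−1 1 ⟩
      geomSum 1 (gcd a b) * Xⁿ−1 1
        ≈⟨ Xⁿ−1≈geomSum*X−1 (gcd a b) ⟨
      Xⁿ−1 (gcd a b) ∎)

  Xˣ−1∣Xᵍ−1*geomSum : ∀ c x → Xⁿ−1 x ∣ Xⁿ−1 (gcd c x) * geomSum c x
  Xˣ−1∣Xᵍ−1*geomSum c x =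
    let u , v , bézout = Xⁿ−1-bézout c x in
    u * geomSum x c + v * geomSum c x , ≈-sym (begin
      Xⁿ−1 (gcd c x) * geomSum c x
        ≈⟨ bézout *ᵣ geomSum c x ⟨
      (u * Xⁿ−1 c + v * Xⁿ−1 x) * geomSum c x
        ≈⟨ solve 5 (λ u a v b s → (u :* a :+ v :* b) :* s := u :* (s :* a) :+ v :* b :* s) ≈-refl u (Xⁿ−1 c) v (Xⁿ−1 x) (geomSum c x) ⟩
      u * (geomSum c x * Xⁿ−1 c) + v * Xⁿ−1 x * geomSum c x
        ≈⟨ u *ₗ geomSum-*-Xⁿ−1 c x +ᵣ v * Xⁿ−1 x * geomSum c x ⟩
      u * Xⁿ−1 (x ℕ.* c) + v * Xⁿ−1 x * geomSum c x
        ≈⟨ u *ₗ ≈-trans (≡⇒≈ (cong Xⁿ−1 (ℕP.*-comm x c))) (≈-sym (geomSum-*-Xⁿ−1 x c)) +ᵣ v * Xⁿ−1 x * geomSum c x ⟩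
      u * (geomSum x c * Xⁿ−1 x) + v * Xⁿ−1 x * geomSum c x
        ≈⟨ solve 5 (λ u a v b y → u :* (a :* y) :+ v :* y :* b := (u :* a :+ v :* b) :* y) ≈-refl u (geomSum x c) v (geomSum c x) (Xⁿ−1 x) ⟩
      (u * geomSum x c + v * geomSum c x) * Xⁿ−1 x ∎)

  geomSum-gcd-∣ : ∀ c x {n} .{{_ : NonZero (gcd c x)}} → x ≡ n ℕ.* gcd c x → geomSum (gcd c x) n ∣ geomSum c x
  geomSum-gcd-∣ c x {n} x≡n*g =
    let W , W*Xˣ−1≈Xᵍ−1*S = Xˣ−1∣Xᵍ−1*geomSum c x in
    W , *-cancelˡ-≈ (Xⁿ−1 g) (∣Xⁿ−1⇒coeff₀≢0 g ∣ʳ-refl) (begin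
      Xⁿ−1 g * (W * geomSum g n)    ≈⟨ solve 3 (λ y w s → y :* (w :* s) := w :* (s :* y)) ≈-refl (Xⁿ−1 g) W (geomSum g n) ⟩
      W * (geomSum g n * Xⁿ−1 g)    ≈⟨ W *ₗ geomSum-*-Xⁿ−1 g n ⟩
      W * Xⁿ−1 (n ℕ.* g)            ≡⟨ cong (λ k → W * Xⁿ−1 k) x≡n*g ⟨
      W * Xⁿ−1 x                    ≈⟨ W*Xˣ−1≈Xᵍ−1*S ⟩
      Xⁿ−1 g * geomSum c x          ∎)
    where g = gcd c x

module CyclotomicFamilies where

  open import Data.Nat as ℕ using (ℕ; zero; suc; NonZero)
  import Data.Nat.Properties as ℕP
  import Algebra.Properties.CommutativeSemigroup ℕP.*-commutativeSemigroup as ℕ*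
  open import Data.Nat.Coprimality as Coprime using (Coprime)
  open import Data.Nat.ListAction using (product)
  open import Data.Nat.ListAction.Properties using (product≢0)
  open import Data.Integer using (+_)
  open import Data.Bool using (Bool; true; false; not)
  open import Data.List using (List; []; _∷_; map; _++_)
  open import Data.List.Relation.Unary.All using (All; []; _∷_)
  open import Data.List.Relation.Unary.AllPairs using (AllPairs; []; _∷_)
  open import Data.Product using (_,_)
  open import Relation.Binary.PropositionalEquality as ≡ using (_≡_; _≢_; cong)

  open PolynomialRing
  open SumsAndProducts
  open GeometricSums
  open Cancellation
  open _∣ʳ_ using (quotient; equality)
  open import Algebra.Properties.CommutativeSemigroup *-commutativeSemigroup
    using (x∙yz≈y∙xz)
  open import Relation.Binary.Reasoning.Setoid setoid

  -- For Q a list of pairwise coprime numbers with product N, the intended instance is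
  --   Φ z = ∏_{S ⊆ Q} (X^(z ∏S) − 1)^((−1)^|Q∖S|),   i.e. Φ_N(X^z) when Q lists the primes of N,
  -- and Ψ z = (X^(zN) − 1) / Φ z.  Only the divisibility relations below are recorded; the
  -- comaximality of the quotients is what lets the family be extended by a further factor.
  record CyclotomicFamily (N : ℕ) (Q : List ℕ) : Set where
    field
      Φ Ψ : ℕ → Poly
      Φ*Ψ : ∀ z → Φ z * Ψ z ≈ Xⁿ−1 (z ℕ.* N)
      Φ-∣ : ∀ {s} → All (Coprime s) Q → ∀ z → Φ z ∣ Φ (s ℕ.* z)
      Φ-∣-quotients-comaximal : ∀ {s t} (s⊥Q : All (Coprime s) Q) (t⊥Q : All (Coprime t) Q) → Coprime s t →
                                ∀ z → Comaximal (quotient (Φ-∣ s⊥Q z)) (quotient (Φ-∣ t⊥Q z))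
      Ψ-∣ : ∀ {s} → All (Coprime s) Q → ∀ z → Ψ z ∣ Ψ (s ℕ.* z)

    Φ∣Xⁿ−1 : ∀ z → Φ z ∣ Xⁿ−1 (z ℕ.* N)
    Φ∣Xⁿ−1 z = Ψ z , ≈-trans (*-comm (Ψ z) (Φ z)) (Φ*Ψ z)

    Φ-coeff₀≢0 : .{{_ : NonZero N}} → ∀ z .{{_ : NonZero z}} → coeff (Φ z) 0 ≢ + 0
    Φ-coeff₀≢0 z = ∣Xⁿ−1⇒coeff₀≢0 (z ℕ.* N) {{ℕP.m*n≢0 z N}} (Φ∣Xⁿ−1 z)

  family[] : CyclotomicFamily 1 []
  family[] = record
    { Φ   = Xⁿ−1
    ; Ψ   = λ _ → 1#
    ; Φ*Ψ = λ z → ≈-trans (*-identityʳ (Xⁿ−1 z)) (≡⇒≈ (cong Xⁿ−1 (≡.sym (ℕP.*-identityʳ z))))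
    ; Φ-∣ = λ {s} _ z → geomSum z s , geomSum-*-Xⁿ−1 z s
    ; Φ-∣-quotients-comaximal = λ _ _ s⊥t z → geomSum-comaximal z s⊥t
    ; Ψ-∣ = λ _ _ → ∣ʳ-refl
    }

  module Extension {N Q} .{{_ : NonZero N}} (F : CyclotomicFamily N Q) (s : ℕ) .{{_ : NonZero s}} (s⊥Q : All (Coprime s) Q) where

    open CyclotomicFamily F

    Φₛ : ℕ → Poly
    Φₛ z = quotient (Φ-∣ s⊥Q z)

    Φₛ*Φ : ∀ z → Φₛ z * Φ z ≈ Φ (s ℕ.* z)
    Φₛ*Φ z = equality (Φ-∣ s⊥Q z)

    Ψₛ : ℕ → Poly
    Ψₛ z = Φ z * Ψ (s ℕ.* z)

    Φₛ*Ψₛ : ∀ z → Φₛ z * Ψₛ z ≈ Xⁿ−1 (z ℕ.* (s ℕ.* N))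
    Φₛ*Ψₛ z = begin
      Φₛ z * (Φ z * Ψ (s ℕ.* z))  ≈⟨ *-assoc (Φₛ z) (Φ z) (Ψ (s ℕ.* z)) ⟨
      Φₛ z * Φ z * Ψ (s ℕ.* z)    ≈⟨ Φₛ*Φ z *ᵣ Ψ (s ℕ.* z) ⟩
      Φ (s ℕ.* z) * Ψ (s ℕ.* z)   ≈⟨ Φ*Ψ (s ℕ.* z) ⟩
      Xⁿ−1 (s ℕ.* z ℕ.* N)        ≡⟨ cong Xⁿ−1 (≡.trans (ℕP.*-assoc s z N) (ℕ*.x∙yz≈y∙xz s z N)) ⟩
      Xⁿ−1 (z ℕ.* (s ℕ.* N))      ∎

    module _ {t} (t⊥s : Coprime t s) (t⊥Q : All (Coprime t) Q) (z : ℕ) .{{_ : NonZero z}} where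

      private
        β γ δ ε : Poly
        β = Φₛ (t ℕ.* z)
        γ = Φₛ z
        δ = quotient (Φ-∣ t⊥Q (s ℕ.* z))
        ε = quotient (Φ-∣ t⊥Q z)

        δ*Φ : δ * Φ (s ℕ.* z) ≈ Φ (t ℕ.* (s ℕ.* z))
        δ*Φ = equality (Φ-∣ t⊥Q (s ℕ.* z))

        ε*Φ : ε * Φ z ≈ Φ (t ℕ.* z)
        ε*Φ = equality (Φ-∣ t⊥Q z)

        β*ε*Φ≈Φ : β * (ε * Φ z) ≈ Φ (t ℕ.* (s ℕ.* z))
        β*ε*Φ≈Φ = begin
          β * (ε * Φ z)          ≈⟨ β *ₗ ε*Φ ⟩
          β * Φ (t ℕ.* z)        ≈⟨ Φₛ*Φ (t ℕ.* z) ⟩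
          Φ (s ℕ.* (t ℕ.* z))    ≡⟨ cong Φ (ℕ*.x∙yz≈y∙xz s t z) ⟩
          Φ (t ℕ.* (s ℕ.* z))    ∎

        εβ≈γδ : ε * β ≈ γ * δ
        εβ≈γδ = *-cancelˡ-≈ (Φ z) (Φ-coeff₀≢0 z) (begin
          Φ z * (ε * β)          ≈⟨ x∙yz≈y∙xz (Φ z) ε β ⟩
          ε * (Φ z * β)          ≈⟨ ε *ₗ *-comm (Φ z) β ⟩
          ε * (β * Φ z)          ≈⟨ x∙yz≈y∙xz ε β (Φ z) ⟩
          β * (ε * Φ z)          ≈⟨ β*ε*Φ≈Φ ⟩
          Φ (t ℕ.* (s ℕ.* z))    ≈⟨ δ*Φ ⟨
          δ * Φ (s ℕ.* z)        ≈⟨ δ *ₗ Φₛ*Φ z ⟨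
          δ * (γ * Φ z)          ≈⟨ solve 3 (λ d g f → d :* (g :* f) := f :* (g :* d)) ≈-refl δ γ (Φ z) ⟩
          Φ z * (γ * δ)          ∎)

      -- Bézout: with U γ + V ε ≈ 1, β ≈ (U γ + V ε) β ≈ γ (U β + V δ) because ε β ≈ γ δ.
      Φₛ-∣⁺ : Φₛ z ∣ Φₛ (t ℕ.* z)
      Φₛ-∣⁺ =
        let U , V , Uγ+Vε≈1 = Φ-∣-quotients-comaximal s⊥Q t⊥Q (Coprime.sym t⊥s) z in
        U * β + V * δ , (begin
          (U * β + V * δ) * γ        ≈⟨ solve 5 (λ u b v d g → (u :* b :+ v :* d) :* g := u :* g :* b :+ v :* (g :* d)) ≈-refl U β V δ γ ⟩
          U * γ * β + V * (γ * δ)    ≈⟨ U * γ * β +ₗ V *ₗ εβ≈γδ ⟨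
          U * γ * β + V * (ε * β)    ≈⟨ solve 5 (λ u g v e b → u :* g :* b :+ v :* (e :* b) := (u :* g :+ v :* e) :* b) ≈-refl U γ V ε β ⟩
          (U * γ + V * ε) * β        ≈⟨ Uγ+Vε≈1 *ᵣ β ⟩
          1# * β                     ≈⟨ *-identityˡ β ⟩
          β                          ∎)

      Φₛ-∣⁺-quotient-∣ : quotient Φₛ-∣⁺ ∣ δ
      Φₛ-∣⁺-quotient-∣ = ε , *-cancelˡ-≈ (Φ (s ℕ.* z)) (Φ-coeff₀≢0 (s ℕ.* z) {{ℕP.m*n≢0 s z}}) (begin
        Φ (s ℕ.* z) * (ε * w)      ≈⟨ *-comm (Φ (s ℕ.* z)) (ε * w) ⟩
        ε * w * Φ (s ℕ.* z)        ≈⟨ ε * w *ₗ Φₛ*Φ z ⟨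
        ε * w * (γ * Φ z)          ≈⟨ solve 4 (λ e w g f → e :* w :* (g :* f) := w :* g :* (e :* f)) ≈-refl ε w γ (Φ z) ⟩
        w * γ * (ε * Φ z)          ≈⟨ equality Φₛ-∣⁺ *ᵣ (ε * Φ z) ⟩
        β * (ε * Φ z)              ≈⟨ β*ε*Φ≈Φ ⟩
        Φ (t ℕ.* (s ℕ.* z))        ≈⟨ δ*Φ ⟨
        δ * Φ (s ℕ.* z)            ≈⟨ *-comm δ (Φ (s ℕ.* z)) ⟩
        Φ (s ℕ.* z) * δ            ∎)
        where w = quotient Φₛ-∣⁺

    Φₛ-∣ : ∀ {t} → All (Coprime t) (s ∷ Q) → ∀ z → Φₛ z ∣ Φₛ (t ℕ.* z)
    Φₛ-∣ {t} _           zero       = ∣ʳ-reflexive (≡⇒≈ (cong Φₛ (≡.sym (ℕP.*-zeroʳ t))))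
    Φₛ-∣     (t⊥s ∷ t⊥Q) z@(suc _) = Φₛ-∣⁺ t⊥s t⊥Q z

    Φₛ-∣-quotients-comaximal : ∀ {t u} (t⊥sQ : All (Coprime t) (s ∷ Q)) (u⊥sQ : All (Coprime u) (s ∷ Q)) → Coprime t u →
                               ∀ z → Comaximal (quotient (Φₛ-∣ t⊥sQ z)) (quotient (Φₛ-∣ u⊥sQ z))
    Φₛ-∣-quotients-comaximal _ _ _ zero =
      1# , 0# , ≈-trans (+-cong (*-identityˡ 1#) (zeroˡ 1#)) (+-identityʳ 1#)
    Φₛ-∣-quotients-comaximal (t⊥s ∷ t⊥Q) (u⊥s ∷ u⊥Q) t⊥u z@(suc _) =
      comaximal-∣ (Φ-∣-quotients-comaximal t⊥Q u⊥Q t⊥u (s ℕ.* z)) (Φₛ-∣⁺-quotient-∣ t⊥s t⊥Q z) (Φₛ-∣⁺-quotient-∣ u⊥s u⊥Q z)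

    Ψₛ-∣ : ∀ {t} → All (Coprime t) (s ∷ Q) → ∀ z → Ψₛ z ∣ Ψₛ (t ℕ.* z)
    Ψₛ-∣ {t} (_ ∷ t⊥Q) z = ∣-respʳ-≈ (≡⇒≈ (cong (λ y → Φ (t ℕ.* z) * Ψ y) (ℕ*.x∙yz≈y∙xz t s z)))
                                      (∙-cong-∣ (Φ-∣ t⊥Q z) (Ψ-∣ t⊥Q (s ℕ.* z)))

    family : CyclotomicFamily (s ℕ.* N) (s ∷ Q)
    family = record
      { Φ = Φₛ ; Ψ = Ψₛ ; Φ*Ψ = Φₛ*Ψₛ ; Φ-∣ = Φₛ-∣ ; Φ-∣-quotients-comaximal = Φₛ-∣-quotients-comaximal ; Ψ-∣ = Ψₛ-∣ }

    Φₛ∣geomSum : ∀ z .{{_ : NonZero z}} → Φₛ z ∣ geomSum (z ℕ.* N) s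
    Φₛ∣geomSum z =
      let λ′ , λ′Ψ≈Ψ = Ψ-∣ s⊥Q z in
      λ′ , *-cancelˡ-≈ (Φ z * Ψ z) (∣Xⁿ−1⇒coeff₀≢0 (z ℕ.* N) {{ℕP.m*n≢0 z N}} (∣ʳ-reflexive (Φ*Ψ z))) (begin
        Φ z * Ψ z * (λ′ * Φₛ z)               ≈⟨ solve 4 (λ f p l g → f :* p :* (l :* g) := g :* f :* (l :* p)) ≈-refl (Φ z) (Ψ z) λ′ (Φₛ z) ⟩
        Φₛ z * Φ z * (λ′ * Ψ z)               ≈⟨ *-cong (Φₛ*Φ z) λ′Ψ≈Ψ ⟩
        Φ (s ℕ.* z) * Ψ (s ℕ.* z)             ≈⟨ Φ*Ψ (s ℕ.* z) ⟩
        Xⁿ−1 (s ℕ.* z ℕ.* N)                  ≡⟨ cong Xⁿ−1 (ℕP.*-assoc s z N) ⟩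
        Xⁿ−1 (s ℕ.* (z ℕ.* N))                ≈⟨ geomSum-*-Xⁿ−1 (z ℕ.* N) s ⟨
        geomSum (z ℕ.* N) s * Xⁿ−1 (z ℕ.* N)  ≈⟨ geomSum (z ℕ.* N) s *ₗ Φ*Ψ z ⟨
        geomSum (z ℕ.* N) s * (Φ z * Ψ z)     ≈⟨ *-comm (geomSum (z ℕ.* N) s) (Φ z * Ψ z) ⟩
        Φ z * Ψ z * geomSum (z ℕ.* N) s       ∎)

  family : (Q : List ℕ) → All NonZero Q → AllPairs Coprime Q → CyclotomicFamily (product Q) Q
  family []      _             _                  = family[]
  family (s ∷ Q) (s≢0 ∷ Q≢0) (s⊥Q ∷ Q-pairwise) =
    Extension.family {{product≢0 Q≢0}} (family Q Q≢0 Q-pairwise) s {{s≢0}} s⊥Q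

  -- exponents true Q z and exponents false Q z list the d = z ∏(Q ∖ S), S ⊆ Q, with |S| even and odd:
  -- the factors X^d − 1 occurring with exponent +1 and −1 in the product formula for Φ_N(X^z).
  exponents : Bool → List ℕ → ℕ → List ℕ
  exponents b     (s ∷ Q) z = exponents b Q (s ℕ.* z) ++ exponents (not b) Q z
  exponents true  []      z = z ∷ []
  exponents false []      z = []

  Π : Bool → List ℕ → ℕ → Poly
  Π b Q z = prodₚ (map Xⁿ−1 (exponents b Q z))

  Π-true≈Φ*Π-false : ∀ Q (Q≢0 : All NonZero Q) (Q-pairwise : AllPairs Coprime Q) z →
                     Π true Q z ≈ CyclotomicFamily.Φ (family Q Q≢0 Q-pairwise) z * Π false Q z
  Π-true≈Φ*Π-false []      _             _                  z = ≈-refl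
  Π-true≈Φ*Π-false (s ∷ Q) (s≢0 ∷ Q≢0) (s⊥Q ∷ Q-pairwise) z = begin
    Π true (s ∷ Q) z                           ≈⟨ prodₚ-map-++ Xⁿ−1 (exponents true Q (s ℕ.* z)) (exponents false Q z) ⟩
    Π true Q (s ℕ.* z) * Π false Q z           ≈⟨ Π-true≈Φ*Π-false Q Q≢0 Q-pairwise (s ℕ.* z) *ᵣ Π false Q z ⟩
    Φ (s ℕ.* z) * Π false Q (s ℕ.* z) * Π false Q z
      ≈⟨ Φₛ*Φ z *ᵣ Π false Q (s ℕ.* z) *ᵣ Π false Q z ⟨
    Φₛ z * Φ z * Π false Q (s ℕ.* z) * Π false Q z
      ≈⟨ solve 4 (λ a f b c → a :* f :* b :* c := a :* (b :* (f :* c))) ≈-refl (Φₛ z) (Φ z) (Π false Q (s ℕ.* z)) (Π false Q z) ⟩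
    Φₛ z * (Π false Q (s ℕ.* z) * (Φ z * Π false Q z))
      ≈⟨ Φₛ z *ₗ (Π false Q (s ℕ.* z) *ₗ Π-true≈Φ*Π-false Q Q≢0 Q-pairwise z) ⟨
    Φₛ z * (Π false Q (s ℕ.* z) * Π true Q z)  ≈⟨ Φₛ z *ₗ prodₚ-map-++ Xⁿ−1 (exponents false Q (s ℕ.* z)) (exponents true Q z) ⟨
    Φₛ z * Π false (s ∷ Q) z                   ∎
    where open CyclotomicFamily (family Q Q≢0 Q-pairwise)
          open Extension {{product≢0 Q≢0}} (family Q Q≢0 Q-pairwise) s {{s≢0}} s⊥Q using (Φₛ; Φₛ*Φ)

module FiltersAndRanges where

  open import Data.Nat using (suc; _≤_; s≤s; z≤n)
  import Data.Nat.Properties as ℕP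
  open import Data.Bool using (Bool; T; not)
  open import Data.Bool.Properties using (T-≡; T-not-≡)
  open import Data.List using (filterᵇ)
  open import Data.List.Membership.Propositional using (_∈_)
  open import Data.List.Membership.Propositional.Properties using (∈-map⁺; ∈-map⁻; ∈-upTo⁺; ∈-upTo⁻; ∈-filter⁺; ∈-filter⁻)
  open import Data.List.Relation.Unary.Unique.Propositional using (Unique)
  import Data.List.Relation.Unary.Unique.Propositional.Properties as Unique
  open import Data.Product using (_×_; _,_)
  open import Function using (_∘_; Equivalence)
  open import Relation.Nullary using (¬_; Dec; yes; no; does)
  open import Relation.Nullary.Decidable using (T?; dec-true; dec-false)
  open import Relation.Binary.PropositionalEquality using (refl)

  T-does⁺ : ∀ {P : Set} (P? : Dec P) → P → T (does P?)
  T-does⁺ P? p = Equivalence.from T-≡ (dec-true P? p)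

  T-does⁻ : ∀ {P : Set} (P? : Dec P) → T (does P?) → P
  T-does⁻ (yes p) _ = p

  T-not-does⁺ : ∀ {P : Set} (P? : Dec P) → ¬ P → T (not (does P?))
  T-not-does⁺ P? ¬p = Equivalence.from T-not-≡ (dec-false P? ¬p)

  T-not-does⁻ : ∀ {P : Set} (P? : Dec P) → T (not (does P?)) → ¬ P
  T-not-does⁻ (no ¬p) _ = ¬p

  ∈-filterᵇ⁺ : ∀ {A : Set} (p : A → Bool) {v} xs → v ∈ xs → T (p v) → v ∈ filterᵇ p xs
  ∈-filterᵇ⁺ p xs = ∈-filter⁺ (T? ∘ p) {xs = xs}

  ∈-filterᵇ⁻ : ∀ {A : Set} (p : A → Bool) {v} xs → v ∈ filterᵇ p xs → v ∈ xs × T (p v)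
  ∈-filterᵇ⁻ p xs = ∈-filter⁻ (T? ∘ p) {xs = xs}

  ∈-range⁺ : ∀ {v n} → 1 ≤ v → v ≤ n → v ∈ range n
  ∈-range⁺ {suc v} _ v≤n = ∈-map⁺ suc (∈-upTo⁺ v≤n)

  ∈-range⁻ : ∀ {v n} → v ∈ range n → 1 ≤ v × v ≤ n
  ∈-range⁻ v∈ with _ , i∈ , refl ← ∈-map⁻ suc v∈ = s≤s z≤n , ∈-upTo⁻ i∈

  range-unique : ∀ n → Unique (range n)
  range-unique n = Unique.map⁺ ℕP.suc-injective (Unique.upTo⁺ n)

module SquarefreeProducts where

  open FiltersAndRanges

  open import Data.Nat as ℕ using (ℕ; zero; suc; _≤_; s≤s; z≤n; NonZero; >-nonZero⁻¹)
  import Data.Nat.Properties as ℕP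
  open import Data.Nat.Divisibility
  open import Data.Nat.DivMod using (_%_; [m+n]%n≡m%n)
  open import Data.Nat.Primality using (Prime; prime?; prime⇒irreducible; ¬prime[1]; prime⇒nonZero; euclidsLemma; productOfPrimes≢0)
  open import Data.Nat.Primality.Factorisation using (factorise; factorisationHasAllPrimeFactors)
  open import Data.Nat.Coprimality as Coprimality using (Coprime; coprime-divisor)
  open import Data.Nat.ListAction using (product)
  open import Data.Nat.ListAction.Properties using (∈⇒∣product)
  open import Data.Integer as ℤ using (ℤ; +_; -_)
  open import Data.Bool using (Bool; true; false; T; not; _∧_; if_then_else_)
  open import Data.Bool.Properties using (T-∧; T-≡)
  open import Data.List using (List; []; _∷_; map; foldr; filterᵇ; length; upTo)
  open import Data.List.Membership.Propositional using (_∈_)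
  open import Data.List.Membership.Propositional.Properties
    using (∈-map⁺; ∈-map⁻; ∈-upTo⁺)
  open import Data.List.Membership.Propositional.Properties.WithK using (unique∧set⇒bag)
  open import Data.List.Relation.Unary.Any using (here; there)
  open import Data.List.Relation.Unary.All as All using (All; []; _∷_)
  open import Data.List.Relation.Unary.AllPairs using (AllPairs; []; _∷_)
  open import Data.List.Relation.Unary.Unique.Propositional using (Unique)
  import Data.List.Relation.Unary.Unique.Propositional.Properties as Unique
  open import Data.List.Relation.Binary.Permutation.Propositional using (_↭_)
  open import Data.List.Relation.Binary.Permutation.Propositional.Properties using (↭-length)
  open import Data.List.Relation.Binary.BagAndSetEquality using (∼bag⇒↭)
  open import Data.Product using (∃; _×_; _,_; proj₁; proj₂)
  open import Data.Sum as Sum using (inj₁; inj₂; [_,_]′)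
  open import Function using (_∘_; id; flip; Equivalence; mk⇔)
  open import Relation.Nullary using (¬_; contradiction; yes; no; does)
  open import Relation.Binary.PropositionalEquality as ≡ using (_≡_; _≢_; refl; cong; cong₂; subst)

  prime≢1 : ∀ {p} → Prime p → p ≢ 1
  prime≢1 p-prime refl = ¬prime[1] p-prime

  prime-∤⇒coprime : ∀ {p n} → Prime p → ¬ p ∣ n → Coprime p n
  prime-∤⇒coprime p-prime p∤n (d∣p , d∣n) with prime⇒irreducible p-prime d∣p
  ... | inj₁ d≡1    = d≡1
  ... | inj₂ refl = contradiction d∣n p∤n

  primes-coprime : ∀ {p q} → Prime p → Prime q → p ≢ q → Coprime p q
  primes-coprime p-prime q-prime p≢q = prime-∤⇒coprime p-prime λ p∣q →
    [ prime≢1 p-prime , p≢q ]′ (prime⇒irreducible q-prime p∣q)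

  prime-coprime-primes : ∀ {p Q} → Prime p → All Prime Q → All (p ≢_) Q → All (Coprime p) Q
  prime-coprime-primes p-prime Q-prime p∉Q =
    All.zipWith (λ (q-prime , p≢q) {d} → primes-coprime p-prime q-prime p≢q {d}) (Q-prime , p∉Q)

  distinctPrimes-pairwiseCoprime : ∀ {P} → Unique P → All Prime P → AllPairs Coprime P
  distinctPrimes-pairwiseCoprime []            []                 = []
  distinctPrimes-pairwiseCoprime (p∉P ∷ P-uniq) (p-prime ∷ P-prime) =
    prime-coprime-primes p-prime P-prime p∉P ∷ distinctPrimes-pairwiseCoprime P-uniq P-prime

  ∃-prime-∣ : ∀ n → 2 ≤ n → ∃ λ p → Prime p × p ∣ n
  ∃-prime-∣ 1 (s≤s ())
  ∃-prime-∣ n@(suc (suc _)) _ with factorise n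
  ... | record { factors = p ∷ ps ; isFactorisation = n≡p*ps ; factorsPrime = p-prime ∷ _ } =
    p , p-prime , divides (product ps) (≡.trans n≡p*ps (ℕP.*-comm p (product ps)))

  prime∣product⇒∈ : ∀ {p S} → Prime p → All Prime S → p ∣ product S → p ∈ S
  prime∣product⇒∈ p-prime S-prime p∣S = factorisationHasAllPrimeFactors p-prime p∣S S-prime

  distinctPrimes-product-∣ : ∀ {S e} → Unique S → All Prime S → All (_∣ e) S → product S ∣ e
  distinctPrimes-product-∣ {[]}    _              _                  _            = 1∣ _
  distinctPrimes-product-∣ {p ∷ S} {e} (p∉S ∷ S-uniq) (p-prime ∷ S-prime) (p∣e ∷ S∣e)
    with divides c e≡c*S ← distinctPrimes-product-∣ S-uniq S-prime S∣e =
    divides (quotient p∣c) e≡c′*pS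
    where
    p⊥S : Coprime p (product S)
    p⊥S = prime-∤⇒coprime p-prime λ p∣S → All.lookup p∉S (prime∣product⇒∈ p-prime S-prime p∣S) refl
    p∣c : p ∣ c
    p∣c = coprime-divisor p⊥S (subst (p ∣_) (≡.trans e≡c*S (ℕP.*-comm c (product S))) p∣e)
    e≡c′*pS : e ≡ quotient p∣c ℕ.* (p ℕ.* product S)
    e≡c′*pS = ≡.trans e≡c*S (≡.trans (cong (ℕ._* product S) (_∣_.equality p∣c)) (ℕP.*-assoc (quotient p∣c) p (product S)))

  T-all⁺ : ∀ (f : ℕ → Bool) xs → (∀ {d} → d ∈ xs → T (f d)) → T (foldr (λ d b → f d ∧ b) true xs)
  T-all⁺ f []       _   = _
  T-all⁺ f (x ∷ xs) all = Equivalence.from T-∧ (all (here refl) , T-all⁺ f xs (all ∘ there))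

  T-all⁻ : ∀ (f : ℕ → Bool) xs → T (foldr (λ d b → f d ∧ b) true xs) → ∀ {d} → d ∈ xs → T (f d)
  T-all⁻ f (x ∷ xs) all (here refl) = proj₁ (Equivalence.to T-∧ all)
  T-all⁻ f (x ∷ xs) all (there d∈) = T-all⁻ f xs (proj₂ (Equivalence.to T-∧ all)) d∈

  -- squarefree n only tests the squares of 2 ≤ d ≤ n + 1.
  squarefree⁺ : ∀ n → (∀ d → 2 ≤ d → ¬ d ℕ.* d ∣ n) → T (squarefree n)
  squarefree⁺ n sqf = T-all⁺ _ (map (2 ℕ.+_) (upTo n)) tested
    where
    tested : ∀ {d} → d ∈ map (2 ℕ.+_) (upTo n) → T (not (does (d ℕ.* d ∣? n)))
    tested d∈ with i , _ , refl ← ∈-map⁻ (2 ℕ.+_) d∈ =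
      T-not-does⁺ ((2 ℕ.+ i) ℕ.* (2 ℕ.+ i) ∣? n) (sqf (2 ℕ.+ i) (s≤s (s≤s z≤n)))

  squarefree⁻ : ∀ n → T (squarefree n) → ∀ d → 2 ≤ d → d ≤ suc n → ¬ d ℕ.* d ∣ n
  squarefree⁻ n sqf d@(suc (suc i)) (s≤s (s≤s _)) (s≤s d≤n) =
    T-not-does⁻ (d ℕ.* d ∣? n) (T-all⁻ _ (map (2 ℕ.+_) (upTo n)) sqf (∈-map⁺ (2 ℕ.+_) (∈-upTo⁺ d≤n)))

  prime∣prime⇒≡ : ∀ {p q} → Prime p → Prime q → q ∣ p → q ≡ p
  prime∣prime⇒≡ p-prime q-prime q∣p =
    [ flip contradiction (prime≢1 q-prime) , id ]′ (prime⇒irreducible p-prime q∣p)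

  prime²∤distinctPrimes : ∀ {p S} → Prime p → Unique S → All Prime S → ¬ p ℕ.* p ∣ product S
  prime²∤distinctPrimes {p} p-prime [] [] pp∣1 =
    prime≢1 p-prime (ℕP.m*n≡1⇒m≡1 p p (∣1⇒≡1 pp∣1))
  prime²∤distinctPrimes {p} {q ∷ S} p-prime (q∉S ∷ S-uniq) (q-prime ∷ S-prime) pp∣qS with p ℕ.≟ q
  ... | yes refl = All.lookup q∉S (prime∣product⇒∈ p-prime S-prime p∣S) refl
    where
    instance _ = prime⇒nonZero p-prime
    p∣S : p ∣ product S
    p∣S = *-cancelˡ-∣ p (subst (p ℕ.* p ∣_) refl pp∣qS)
  ... | no p≢q = prime²∤distinctPrimes p-prime S-uniq S-prime (coprime-divisor pp⊥q pp∣qS)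
    where
    q∤pp : ¬ q ∣ p ℕ.* p
    q∤pp q∣pp = p≢q (≡.sym ([ id , id ]′ (Sum.map (prime∣prime⇒≡ p-prime q-prime) (prime∣prime⇒≡ p-prime q-prime)
                                                         (euclidsLemma p p q-prime q∣pp))))
    pp⊥q : Coprime (p ℕ.* p) q
    pp⊥q = Coprimality.sym (prime-∤⇒coprime q-prime q∤pp)

  squarefree-distinctPrimes : ∀ {S} → Unique S → All Prime S → T (squarefree (product S))
  squarefree-distinctPrimes {S} S-uniq S-prime = squarefree⁺ (product S) λ d 2≤d dd∣S →
    let p , p-prime , p∣d = ∃-prime-∣ d 2≤d in
    prime²∤distinctPrimes p-prime S-uniq S-prime (∣-trans (*-pres-∣ p∣d p∣d) dd∣S)

  primeDivisors : ℕ → List ℕ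
  primeDivisors n = filterᵇ (λ p → does (prime? p) ∧ does (p ∣? n)) (range n)

  ∈-primeDivisors⁺ : ∀ {n p} .{{_ : NonZero n}} → Prime p → p ∣ n → p ∈ primeDivisors n
  ∈-primeDivisors⁺ {n} {p} p-prime p∣n =
    ∈-filterᵇ⁺ _ (range n) (∈-range⁺ (>-nonZero⁻¹ p {{prime⇒nonZero p-prime}}) (∣⇒≤ p∣n))
      (Equivalence.from T-∧ (T-does⁺ (prime? p) p-prime , T-does⁺ (p ∣? n) p∣n))

  ∈-primeDivisors⁻ : ∀ {n p} → p ∈ primeDivisors n → Prime p × p ∣ n
  ∈-primeDivisors⁻ {n} {p} p∈ =
    let p-prime , p∣n = Equivalence.to T-∧ (proj₂ (∈-filterᵇ⁻ _ (range n) p∈)) in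
    T-does⁻ (prime? p) p-prime , T-does⁻ (p ∣? n) p∣n

  primeDivisors-unique : ∀ n → Unique (primeDivisors n)
  primeDivisors-unique n = Unique.filter⁺ _ (range-unique n)

  primeDivisors-distinctPrimes : ∀ {S} → Unique S → All Prime S → primeDivisors (product S) ↭ S
  primeDivisors-distinctPrimes {S} S-uniq S-prime =
    ∼bag⇒↭ (unique∧set⇒bag (primeDivisors-unique (product S)) S-uniq (mk⇔ to from))
    where
    instance _ = productOfPrimes≢0 S-prime
    to : ∀ {p} → p ∈ primeDivisors (product S) → p ∈ S
    to p∈ = let p-prime , p∣S = ∈-primeDivisors⁻ p∈ in prime∣product⇒∈ p-prime S-prime p∣S
    from : ∀ {p} → p ∈ S → p ∈ primeDivisors (product S)
    from p∈S = ∈-primeDivisors⁺ (All.lookup S-prime p∈S) (∈⇒∣product p∈S)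

  isEven : ℕ → Bool
  isEven n = does (n % 2 ℕ.≟ 0)

  isEven-suc : ∀ n → isEven (suc n) ≡ not (isEven n)
  isEven-suc zero          = refl
  isEven-suc (suc zero)    = refl
  isEven-suc (suc (suc n)) = ≡.trans (cong (λ r → does (r % 2 ℕ.≟ 0)) (ℕP.+-comm 2 (suc n)))
    (≡.trans (cong (λ r → does (r ℕ.≟ 0)) ([m+n]%n≡m%n (suc n) 2)) (isEven-suc n))

  sign : Bool → ℤ
  sign b = if b then + 1 else - (+ 1)

  sign-injective : ∀ {b b′} → sign b ≡ sign b′ → b ≡ b′
  sign-injective {true}  {true}  _ = refl
  sign-injective {false} {false} _ = refl

  μ-distinctPrimes : ∀ {S} → Unique S → All Prime S → μ (product S) ≡ sign (isEven (length S))
  μ-distinctPrimes S-uniq S-prime =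
    cong₂ (λ sqf k → if sqf then sign (isEven k) else + 0)
          (Equivalence.to T-≡ (squarefree-distinctPrimes S-uniq S-prime)) (↭-length (primeDivisors-distinctPrimes S-uniq S-prime))

  ¬squarefree⇒μ≢sign : ∀ {n} b → ¬ T (squarefree n) → μ n ≢ sign b
  ¬squarefree⇒μ≢sign {n} b ¬sqf with squarefree n
  ¬squarefree⇒μ≢sign b     ¬sqf | true  = contradiction _ ¬sqf
  ¬squarefree⇒μ≢sign true  ¬sqf | false = λ ()
  ¬squarefree⇒μ≢sign false ¬sqf | false = λ ()

module MöbiusProduct where

  open import Data.Nat as ℕ using (ℕ; zero; suc; s≤s; z≤n; NonZero; ≢-nonZero; ≢-nonZero⁻¹)
  import Data.Nat.Properties as ℕP
  open import Data.Nat.Divisibility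
  open import Data.Nat.DivMod using (_/_)
  open import Data.Nat.Primality using (Prime; prime⇒nonZero; prime⇒nonTrivial; productOfPrimes≢0)
  open import Data.Nat.ListAction using (product)
  open import Data.Nat.ListAction.Properties using (∈⇒∣product)
  open import Data.Integer as ℤ using (ℤ)
  open import Data.Bool using (Bool; true; false; T; not; _∧_)
  open import Data.Bool.Properties using (T-∧; not-involutive)
  open import Data.List using (List; []; _∷_; map; filterᵇ; length; upTo)
  open import Data.List.Membership.Propositional using (_∈_)
  open import Data.List.Membership.Propositional.Properties using (∈-++⁻; ∈-++⁺ˡ; ∈-++⁺ʳ; ∈-map⁺; ∈-map⁻; ∈-upTo⁺)
  open import Data.List.Membership.Propositional.Properties.WithK using (unique∧set⇒bag)
  open import Data.List.Relation.Unary.Any using (here; there)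
  open import Data.List.Relation.Unary.All as All using (All; []; _∷_)
  import Data.List.Relation.Unary.All.Properties as All
  open import Data.List.Relation.Unary.Unique.Propositional using (Unique; []; _∷_)
  import Data.List.Relation.Unary.Unique.Propositional.Properties as Unique
  open import Data.List.Relation.Binary.Sublist.Propositional using (_⊆_; []; _∷_; _∷ʳ_)
  open import Data.List.Relation.Binary.Sublist.Propositional.Properties using (All-resp-⊆; Any-resp-⊆; filter-⊆)
  open import Data.List.Relation.Binary.Permutation.Propositional using (_↭_)
  open import Data.List.Relation.Binary.BagAndSetEquality using (∼bag⇒↭)
  open import Data.Product using (∃; _×_; _,_; proj₁; proj₂)
  open import Data.Sum using (inj₁; inj₂)
  open import Function using (_∘_; Equivalence; mk⇔)
  open import Relation.Nullary using (¬_; contradiction; yes; no; does; decidable-stable)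
  open import Relation.Nullary.Decidable using (T?)
  open import Relation.Binary.PropositionalEquality as ≡ using (_≡_; _≢_; refl; cong; subst)
  import Algebra.Properties.CommutativeSemigroup ℕP.*-commutativeSemigroup as ℕ*

  open FiltersAndRanges
  open SquarefreeProducts
  open CyclotomicFamilies using (exponents)

  unique-⊆ : ∀ {xs ys : List ℕ} → xs ⊆ ys → Unique ys → Unique xs
  unique-⊆ []         []            = []
  unique-⊆ (y ∷ʳ τ)   (_ ∷ ys-uniq)  = unique-⊆ τ ys-uniq
  unique-⊆ (refl ∷ τ) (y∉ ∷ ys-uniq) = All-resp-⊆ τ y∉ ∷ unique-⊆ τ ys-uniq

  Cofactor : Bool → List ℕ → ℕ → ℕ → Set
  Cofactor b Q z d = ∃ λ S → S ⊆ Q × isEven (length S) ≡ b × d ℕ.* product S ≡ z ℕ.* product Q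

  ∈-exponents⁻ : ∀ b Q z {d} → d ∈ exponents b Q z → Cofactor b Q z d
  ∈-exponents⁻ true  []      z (here refl) = [] , [] , refl , refl
  ∈-exponents⁻ b     (s ∷ Q) z {d} d∈ with ∈-++⁻ (exponents b Q (s ℕ.* z)) d∈
  ... | inj₁ d∈ˡ = let S , τ , S-even , d*S≡sz*Q = ∈-exponents⁻ b Q (s ℕ.* z) d∈ˡ in
    S , s ∷ʳ τ , S-even , ≡.trans d*S≡sz*Q (ℕ*.xy∙z≈y∙xz s z (product Q))
  ... | inj₂ d∈ʳ = let S , τ , S-even , d*S≡z*Q = ∈-exponents⁻ (not b) Q z d∈ʳ in
    s ∷ S , refl ∷ τ , ≡.trans (isEven-suc (length S)) (≡.trans (cong not S-even) (not-involutive b)) ,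
    ≡.trans (ℕ*.x∙yz≈y∙xz d s (product S)) (≡.trans (cong (s ℕ.*_) d*S≡z*Q) (ℕ*.x∙yz≈y∙xz s z (product Q)))

  ∈-exponents⁺ : ∀ b {Q S} z {d} → All NonZero Q → S ⊆ Q → isEven (length S) ≡ b → d ℕ.* product S ≡ z ℕ.* product Q →
                 d ∈ exponents b Q z
  ∈-exponents⁺ true z {d} [] [] refl d*1≡z*1 =
    here (≡.trans (≡.sym (ℕP.*-identityʳ d)) (≡.trans d*1≡z*1 (ℕP.*-identityʳ z)))
  ∈-exponents⁺ b {s ∷ Q} z (_ ∷ Q≢0) (s ∷ʳ τ) S-even d*S≡z*sQ =
    ∈-++⁺ˡ (∈-exponents⁺ b (s ℕ.* z) Q≢0 τ S-even (≡.trans d*S≡z*sQ (≡.sym (ℕ*.xy∙z≈y∙xz s z (product Q)))))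
  ∈-exponents⁺ b {s ∷ Q} {s ∷ S} z {d} (s≢0 ∷ Q≢0) (refl ∷ τ) sS-even d*sS≡z*sQ =
    ∈-++⁺ʳ (exponents b Q (s ℕ.* z)) (∈-exponents⁺ (not b) z Q≢0 τ S-even d*S≡z*Q)
    where
    S-even : isEven (length S) ≡ not b
    S-even = ≡.trans (≡.sym (not-involutive _)) (cong not (≡.trans (≡.sym (isEven-suc (length S))) sS-even))
    d*S≡z*Q : d ℕ.* product S ≡ z ℕ.* product Q
    d*S≡z*Q = ℕP.*-cancelˡ-≡ _ _ s {{s≢0}}
      (≡.trans (ℕ*.x∙yz≈y∙xz s d (product S)) (≡.trans d*sS≡z*sQ (ℕ*.x∙yz≈y∙xz z s (product Q))))

  exponents-unique : ∀ b {Q} z .{{_ : NonZero z}} → Unique Q → All Prime Q → Unique (exponents b Q z)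
  exponents-unique true  {[]}    z _ _ = [] ∷ []
  exponents-unique false {[]}    z _ _ = []
  exponents-unique b     {s ∷ Q} z (s∉Q ∷ Q-uniq) (s-prime ∷ Q-prime) =
    Unique.++⁺ (exponents-unique b (s ℕ.* z) {{ℕP.m*n≢0 s z {{prime⇒nonZero s-prime}}}} Q-uniq Q-prime)
               (exponents-unique (not b) z Q-uniq Q-prime)
               disjoint
    where
    instance _ = productOfPrimes≢0 Q-prime
    -- A common member d would give d ∏S₁ = s z ∏Q = s d ∏S₂, so s ∣ ∏S₁ and the prime s lies in S₁ ⊆ Q.
    disjoint : ∀ {d} → ¬ (d ∈ exponents b Q (s ℕ.* z) × d ∈ exponents (not b) Q z)
    disjoint {d} (d∈₁ , d∈₂) =
      let S₁ , τ₁ , _ , d*S₁≡sz*Q = ∈-exponents⁻ b Q (s ℕ.* z) d∈₁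
          S₂ , τ₂ , _ , d*S₂≡z*Q  = ∈-exponents⁻ (not b) Q z d∈₂
          instance
            _ : NonZero d
            _ = ≢-nonZero λ { refl → ≢-nonZero⁻¹ (z ℕ.* product Q) {{ℕP.m*n≢0 z (product Q)}} (≡.sym d*S₂≡z*Q) }
          S₁≡s*S₂ : product S₁ ≡ s ℕ.* product S₂
          S₁≡s*S₂ = ℕP.*-cancelˡ-≡ _ _ d (≡.trans d*S₁≡sz*Q (≡.trans (ℕP.*-assoc s z (product Q))
                      (≡.trans (cong (s ℕ.*_) (≡.sym d*S₂≡z*Q)) (ℕ*.x∙yz≈y∙xz s d (product S₂)))))
          s∈S₁ = prime∣product⇒∈ s-prime (All-resp-⊆ τ₁ Q-prime) (divides (product S₂) (≡.trans S₁≡s*S₂ (ℕP.*-comm s _)))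
      in All.lookup s∉Q (Any-resp-⊆ τ₁ s∈S₁) refl

  record IsPrimeDivisorList (x : ℕ) (P : List ℕ) : Set where
    field
      unique   : Unique P
      primes   : All Prime P
      divide   : All (_∣ x) P
      complete : ∀ {p} → Prime p → p ∣ x → p ∈ P

  primeDivisors-isPrimeDivisorList : ∀ x .{{_ : NonZero x}} → IsPrimeDivisorList x (primeDivisors x)
  primeDivisors-isPrimeDivisorList x = record
    { unique   = primeDivisors-unique x
    ; primes   = All.tabulate (proj₁ ∘ ∈-primeDivisors⁻ {x})
    ; divide   = All.tabulate (proj₂ ∘ ∈-primeDivisors⁻ {x})
    ; complete = ∈-primeDivisors⁺
    }

  without : ℕ → List ℕ → List ℕ
  without p = filterᵇ (λ q → not (does (q ℕ.≟ p)))

  moveToFront : ∀ {x P p} → IsPrimeDivisorList x P → Prime p → p ∣ x → IsPrimeDivisorList x (p ∷ without p P)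
  moveToFront {x} {P} {p} P-list p-prime p∣x = record
    { unique   = All.tabulate (λ q∈ p≡q → T-not-does⁻ (_ ℕ.≟ p) (proj₂ (∈-filterᵇ⁻ _ P q∈)) (≡.sym p≡q))
                   ∷ Unique.filter⁺ _ unique
    ; primes   = p-prime ∷ All.filter⁺ _ primes
    ; divide   = p∣x ∷ All.filter⁺ _ divide
    ; complete = complete′
    }
    where
    open IsPrimeDivisorList P-list
    complete′ : ∀ {q} → Prime q → q ∣ x → q ∈ p ∷ without p P
    complete′ {q} q-prime q∣x with q ℕ.≟ p
    ... | yes refl = here refl
    ... | no q≢p   = there (∈-filterᵇ⁺ _ P (complete q-prime q∣x) (T-not-does⁺ (q ℕ.≟ p) q≢p))

  -- The primes of P dividing e multiply to a divisor c ∏S = e of e; a prime factor r of c would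
  -- also lie in S, making r² ∣ e.
  squarefree∣⇒subproduct : ∀ {x P e} → IsPrimeDivisorList x P → .{{_ : NonZero e}} → e ∣ x → T (squarefree e) →
                           ∃ λ S → S ⊆ P × product S ≡ e
  squarefree∣⇒subproduct {x} {P} {e} P-list e∣x e-sqf =
    S , filter-⊆ _ P , S≡e (distinctPrimes-product-∣ (Unique.filter⁺ _ unique) (All.filter⁺ _ primes) S∣e)
    where
    open IsPrimeDivisorList P-list
    S = filterᵇ (λ q → does (q ∣? e)) P
    S∣e : All (_∣ e) S
    S∣e = All.tabulate λ q∈ → T-does⁻ (_ ∣? e) (proj₂ (∈-filterᵇ⁻ _ P q∈))
    S≡e : product S ∣ e → product S ≡ e
    S≡e (divides zero                e≡0)   = contradiction e≡0 (≢-nonZero⁻¹ e)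
    S≡e (divides (suc zero)          e≡1*S) = ≡.sym (≡.trans e≡1*S (ℕP.*-identityˡ _))
    S≡e (divides c@(suc (suc _))     e≡c*S) =
      let r , r-prime , r∣c = ∃-prime-∣ c (s≤s (s≤s z≤n))
          r∣e = ∣-trans r∣c (divides (product S) (≡.trans e≡c*S (ℕP.*-comm c (product S))))
          r∈S = ∈-filterᵇ⁺ _ P (complete r-prime (∣-trans r∣e e∣x)) (T-does⁺ (r ∣? e) r∣e)
      in contradiction (subst (r ℕ.* r ∣_) (≡.sym e≡c*S) (*-pres-∣ r∣c (∈⇒∣product r∈S)))
                       (squarefree⁻ e e-sqf r (ℕ.nonTrivial⇒n>1 r {{prime⇒nonTrivial r-prime}}) (ℕP.m≤n⇒m≤1+n (∣⇒≤ r∣e)))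

  module Factorisation {x P} .{{_ : NonZero x}} (P-list : IsPrimeDivisorList x P) where

    open IsPrimeDivisorList P-list

    P∣x : product P ∣ x
    P∣x = distinctPrimes-product-∣ unique primes divide

    m : ℕ
    m = quotient P∣x

    x≡m*P : x ≡ m ℕ.* product P
    x≡m*P = _∣_.equality P∣x

    instance
      m≢0 : NonZero m
      m≢0 = ≢-nonZero λ m≡0 → ≢-nonZero⁻¹ x (≡.trans x≡m*P (cong (ℕ._* product P) m≡0))

    divisorsWithμ : Bool → List ℕ
    divisorsWithμ b = filterᵇ (λ i → does (suc i ∣? x) ∧ does (μ (x / suc i) ℤ.≟ sign b)) (upTo x)

    private
      P≢0 : All NonZero P
      P≢0 = All.map prime⇒nonZero primes

      sub-unique : ∀ {S} → S ⊆ P → Unique S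
      sub-unique τ = unique-⊆ τ unique

      sub-primes : ∀ {S} → S ⊆ P → All Prime S
      sub-primes τ = All-resp-⊆ τ primes

    -- μ q = ±1 makes q squarefree, hence q = ∏S for the primes S ⊆ P dividing q, and x = d ∏S.
    μ-cofactor⇒∈exponents : ∀ b {d q} → x ≡ q ℕ.* d → μ q ≡ sign b → d ∈ exponents b P m
    μ-cofactor⇒∈exponents b {d} {q} x≡q*d μq≡sign =
      let S , τ , S≡q = squarefree∣⇒subproduct P-list (divides d (≡.trans x≡q*d (ℕP.*-comm q d))) q-squarefree
          S-even = sign-injective (≡.trans (≡.sym (μ-distinctPrimes (sub-unique τ) (sub-primes τ))) (≡.trans (cong μ S≡q) μq≡sign))
      in ∈-exponents⁺ b m P≢0 τ S-even (≡.trans (cong (d ℕ.*_) S≡q) (≡.trans (ℕP.*-comm d q) (≡.trans (≡.sym x≡q*d) x≡m*P)))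
      where
      instance
        q≢0 : NonZero q
        q≢0 = ≢-nonZero λ q≡0 → ≢-nonZero⁻¹ x (≡.trans x≡q*d (cong (ℕ._* d) q≡0))
      q-squarefree : T (squarefree q)
      q-squarefree = decidable-stable (T? (squarefree q)) (λ ¬sqf → ¬squarefree⇒μ≢sign {q} b ¬sqf μq≡sign)

    divisorsWithμ⊆exponents : ∀ b {d} → d ∈ map suc (divisorsWithμ b) → d ∈ exponents b P m
    divisorsWithμ⊆exponents b d∈ with i , i∈ , refl ← ∈-map⁻ suc d∈ =
      let i∣x , μ≡sign = Equivalence.to T-∧ (proj₂ (∈-filterᵇ⁻ _ (upTo x) i∈))
          d∣x@(divides q x≡q*d) = T-does⁻ (suc i ∣? x) i∣x
      in μ-cofactor⇒∈exponents b {q = q} x≡q*d (≡.trans (cong μ (≡.sym (n/m≡quotient d∣x))) (T-does⁻ (_ ℤ.≟ sign b) μ≡sign))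

    exponents⊆divisorsWithμ : ∀ b {d} → d ∈ exponents b P m → d ∈ map suc (divisorsWithμ b)
    exponents⊆divisorsWithμ b {d} d∈ with ∈-exponents⁻ b P m d∈
    ... | S , τ , S-even , d*S≡m*P with d
    ...   | zero  = contradiction (≡.trans x≡m*P (≡.sym d*S≡m*P)) (≢-nonZero⁻¹ x)
    ...   | suc i =
      let d∣x = divides (product S) (≡.trans x≡m*P (≡.trans (≡.sym d*S≡m*P) (ℕP.*-comm (suc i) (product S))))
          μ≡sign = ≡.trans (cong μ (n/m≡quotient d∣x)) (≡.trans (μ-distinctPrimes (sub-unique τ) (sub-primes τ)) (cong sign S-even))
      in ∈-map⁺ suc (∈-filterᵇ⁺ _ (upTo x) (∈-upTo⁺ (∣⇒≤ d∣x))
           (Equivalence.from T-∧ (T-does⁺ (suc i ∣? x) d∣x , T-does⁺ (μ (x / suc i) ℤ.≟ sign b) μ≡sign)))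

    divisorsWithμ-↭ : ∀ b → map suc (divisorsWithμ b) ↭ exponents b P m
    divisorsWithμ-↭ b = ∼bag⇒↭ (unique∧set⇒bag
      (Unique.map⁺ ℕP.suc-injective (Unique.filter⁺ _ (Unique.upTo⁺ x))) (exponents-unique b m unique primes)
      (mk⇔ (divisorsWithμ⊆exponents b) (exponents⊆divisorsWithμ b)))

module VanishingAtζ where

  open import Data.Nat as ℕ using (ℕ; suc; NonZero)
  import Data.Nat.Properties as ℕP
  import Algebra.Properties.CommutativeSemigroup ℕP.*-commutativeSemigroup as ℕ*
  import Data.Nat.Divisibility as ℕ
  open import Data.Nat.Primality using (Prime; prime⇒nonZero)
  open import Data.Nat.ListAction using (product)
  open import Data.Nat.ListAction.Properties using (product≢0)
  open import Data.Bool using (true; false)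
  open import Data.List using (map; _∷_)
  open import Data.List.Properties using (map-∘)
  import Data.List.Relation.Unary.All as All
  open import Data.List.Relation.Unary.All using (_∷_)
  open import Data.List.Relation.Unary.Unique.Propositional using (_∷_)
  open import Data.Product using (_,_)
  open import Relation.Binary.PropositionalEquality as ≡ using (_≡_; cong)

  open PolynomialRing
  open SumsAndProducts using (prodₚ-map-↭)
  open GeometricSums
  open CyclotomicFamilies
  open SquarefreeProducts using (distinctPrimes-pairwiseCoprime; prime-coprime-primes; primeDivisors)
  open MöbiusProduct using (IsPrimeDivisorList; primeDivisors-isPrimeDivisorList; moveToFront; without; module Factorisation)
  open import Relation.Binary.Reasoning.Setoid setoid

  VanishesAtζₓ : ℕ → Poly → Set
  VanishesAtζₓ x F = cycNum x ∣ F * cycDen x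

  module _ {x P} .{{_ : NonZero x}} (P-list : IsPrimeDivisorList x P) where

    open IsPrimeDivisorList P-list
    open Factorisation P-list

    radicalFamily : CyclotomicFamily (product P) P
    radicalFamily = family P (All.map prime⇒nonZero primes) (distinctPrimes-pairwiseCoprime unique primes)

    open CyclotomicFamily radicalFamily using (Φ; Φ∣Xⁿ−1)

    Φ∣Xˣ−1 : Φ m ∣ Xⁿ−1 x
    Φ∣Xˣ−1 = ∣-respʳ-≈ (≡⇒≈ (cong Xⁿ−1 (≡.sym x≡m*P))) (Φ∣Xⁿ−1 m)

    prodXⁿ−1-divisorsWithμ : ∀ b → prodₚ (map (λ i → Xⁿ−1 (suc i)) (divisorsWithμ b)) ≈ Π b P m
    prodXⁿ−1-divisorsWithμ b = ≈-trans (≡⇒≈ (cong prodₚ (map-∘ (divisorsWithμ b)))) (prodₚ-map-↭ Xⁿ−1 (divisorsWithμ-↭ b))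

    Φ-∣⇒vanishes : ∀ {F} → Φ m ∣ F → VanishesAtζₓ x F
    Φ-∣⇒vanishes {F} (c , cΦ≈F) = c , (begin
      c * cycNum x                ≈⟨ c *ₗ prodXⁿ−1-divisorsWithμ true ⟩
      c * Π true P m              ≈⟨ c *ₗ Π-true≈Φ*Π-false P _ _ m ⟩
      c * (Φ m * Π false P m)     ≈⟨ *-assoc c (Φ m) (Π false P m) ⟨
      c * Φ m * Π false P m       ≈⟨ cΦ≈F *ᵣ Π false P m ⟩
      F * Π false P m             ≈⟨ F *ₗ prodXⁿ−1-divisorsWithμ false ⟨
      F * cycDen x                ∎)

  Xⁿ−1-vanishes : ∀ x .{{_ : NonZero x}} → VanishesAtζₓ x (Xⁿ−1 x)
  Xⁿ−1-vanishes x = Φ-∣⇒vanishes P-list (Φ∣Xˣ−1 P-list)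
    where P-list = primeDivisors-isPrimeDivisorList x

  -- With p listed first, Φ m is the quotient Φ_T(p m) / Φ_T(m) for T the remaining primes, which divides
  -- the geometric sum 1 + Y + ⋯ + Y^(p−1) in Y = X^(m ∏T).
  Φ∣geomSum : ∀ {x p T} .{{_ : NonZero x}} (P-list : IsPrimeDivisorList x (p ∷ T)) →
              let open Factorisation P-list in CyclotomicFamily.Φ (radicalFamily P-list) m ∣ geomSum (m ℕ.* product T) p
  Φ∣geomSum {p = p} P-list@record { unique = p∉T ∷ T-unique ; primes = p-prime ∷ T-primes } =
    Extension.Φₛ∣geomSum {{product≢0 T≢0}} (family _ T≢0 (distinctPrimes-pairwiseCoprime T-unique T-primes))
                         p {{prime⇒nonZero p-prime}} (prime-coprime-primes p-prime T-primes p∉T) m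
    where
    T≢0 = All.map prime⇒nonZero T-primes
    open Factorisation P-list using (m; m≢0)

  geomSum-vanishes : ∀ {x p w} .{{_ : NonZero x}} → Prime p → w ℕ.* p ≡ x → VanishesAtζₓ x (geomSum w p)
  geomSum-vanishes {x} {p} {w} p-prime w*p≡x =
    Φ-∣⇒vanishes P-list (∣-respʳ-≈ (≡⇒≈ (cong (λ v → geomSum v p) (≡.sym w≡m*T))) (Φ∣geomSum P-list))
    where
    P-list = moveToFront (primeDivisors-isPrimeDivisorList x) p-prime (ℕ.divides w (≡.sym w*p≡x))
    open Factorisation P-list using (m; x≡m*P)
    T = without p (primeDivisors x)
    w≡m*T : w ≡ m ℕ.* product T
    w≡m*T = ℕP.*-cancelʳ-≡ w (m ℕ.* product T) p {{prime⇒nonZero p-prime}}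
      (≡.trans w*p≡x (≡.trans x≡m*P (ℕ*.x∙yz≈xz∙y m p (product T))))

module CongruenceAtζ (x : ℕ) .{{_ : NonZero x}} where

  open import Data.Integer using (+_)
  open import Data.List using ([]; _∷_; map)
  open import Data.List.Membership.Propositional using (_∈_)
  open import Data.List.Relation.Unary.Any using (here; there)
  open import Data.Product using (_,_)
  open import Function using (_∘_)
  open import Relation.Binary.PropositionalEquality as ≡ using (refl)

  open PolynomialRing
  open VanishingAtζ using (VanishesAtζₓ)

  private
    V : Poly → Set
    V = VanishesAtζₓ x

  vanishes-resp-≈ : ∀ {F G} → F ≈ G → V F → V G
  vanishes-resp-≈ F≈G (h , h*num≈F*den) = h , ≈-trans h*num≈F*den (F≈G *ᵣ cycDen x)

  vanishes-∣ : ∀ {F G} → F ∣ G → V F → V G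
  vanishes-∣ {F} {G} (c , cF≈G) (h , h*num≈F*den) = c * h , (begin
    c * h * cycNum x      ≈⟨ *-assoc c h (cycNum x) ⟩
    c * (h * cycNum x)    ≈⟨ c *ₗ h*num≈F*den ⟩
    c * (F * cycDen x)    ≈⟨ *-assoc c F (cycDen x) ⟨
    c * F * cycDen x      ≈⟨ cF≈G *ᵣ cycDen x ⟩
    G * cycDen x          ∎)
    where open import Relation.Binary.Reasoning.Setoid setoid

  vanishes-+ : ∀ F G → V F → V G → V (F + G)
  vanishes-+ F G (h , hN≈FD) (h′ , h′N≈GD) =
    h + h′ , ≈-trans (distribʳ (cycNum x) h h′) (≈-trans (+-cong hN≈FD h′N≈GD) (≈-sym (distribʳ (cycDen x) F G)))

  vanishes-0 : V 0#
  vanishes-0 = 0# , ≈-refl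

  infix 4 _∼_
  record _∼_ (F G : Poly) : Set where
    constructor mk∼
    field vanishes : V (F - G)
  open _∼_ public

  ≈⇒∼ : ∀ {F G} → F ≈ G → F ∼ G
  ≈⇒∼ {F} {G} F≈G = mk∼ (vanishes-resp-≈ (≈-sym (≈-trans (F≈G +ᵣ - G) (-‿inverseʳ G))) vanishes-0)

  ∼-sym : ∀ {F G} → F ∼ G → G ∼ F
  ∼-sym {F} {G} (mk∼ v) =
    mk∼ (vanishes-∣ (- 1# , solve 2 (λ f g → :- con (+ 1) :* (f :- g) := g :- f) ≈-refl F G) v)

  ∼-trans : ∀ {F G H} → F ∼ G → G ∼ H → F ∼ H
  ∼-trans {F} {G} {H} (mk∼ v) (mk∼ v′) =
    mk∼ (vanishes-resp-≈ (solve 3 (λ f g h → (f :- g) :+ (g :- h) := f :- h) ≈-refl F G H) (vanishes-+ (F - G) (G - H) v v′))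

  +-cong-∼ : ∀ {F F′ G G′} → F ∼ F′ → G ∼ G′ → F + G ∼ F′ + G′
  +-cong-∼ {F} {F′} {G} {G′} (mk∼ v) (mk∼ v′) =
    mk∼ (vanishes-resp-≈ (solve 4 (λ f f′ g g′ → (f :- f′) :+ (g :- g′) := (f :+ g) :- (f′ :+ g′)) ≈-refl F F′ G G′)
                         (vanishes-+ (F - F′) (G - G′) v v′))

  *-cong-∼ : ∀ {F F′ G G′} → F ∼ F′ → G ∼ G′ → F * G ∼ F′ * G′
  *-cong-∼ {F} {F′} {G} {G′} (mk∼ v) (mk∼ v′) =
    mk∼ (vanishes-resp-≈ (solve 4 (λ f f′ g g′ → g :* (f :- f′) :+ f′ :* (g :- g′) := f :* g :- f′ :* g′) ≈-refl F F′ G G′)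
                         (vanishes-+ (G * (F - F′)) (F′ * (G - G′)) (vanishes-∣ (G , ≈-refl) v) (vanishes-∣ (F′ , ≈-refl) v′)))

  sumₚ-cong-∼ : ∀ {A : Set} {f g : A → Poly} xs → (∀ {a} → a ∈ xs → f a ∼ g a) → sumₚ (map f xs) ∼ sumₚ (map g xs)
  sumₚ-cong-∼ []       f∼g = ≈⇒∼ ≈-refl
  sumₚ-cong-∼ (a ∷ xs) f∼g = +-cong-∼ (f∼g (here refl)) (sumₚ-cong-∼ xs (f∼g ∘ there))

  module ∼-Reasoning where
    open import Relation.Binary.Reasoning.Base.Single _∼_ (≈⇒∼ ≈-refl) ∼-trans public
    open import Relation.Binary.Reasoning.Syntax using (module ≈-syntax)
    open ≈-syntax _IsRelatedTo_ _IsRelatedTo_ (∼-go ∘ ≈⇒∼) ≈-sym public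

  vanishes⇒∼0 : ∀ {F} → V F → F ∼ 0#
  vanishes⇒∼0 {F} v = mk∼ (vanishes-resp-≈ (≈-sym (+-identityʳ F)) v)

  ∼constₚ⇒EvalEq : ∀ {P N} → P ∼ constₚ N → EvalEq x P N
  ∼constₚ⇒EvalEq (mk∼ (H , H*num≈[P-N]*den)) = H , λ i → ≡.sym (coeff-≡ H*num≈[P-N]*den i)

module PowerSumsAtζ (x : ℕ) .{{_ : NonZero x}} where

  open import Data.Nat as ℕ using (ℕ; zero; suc; NonZero; _≤_; s≤s; z≤n)
  import Data.Nat.Properties as ℕP
  import Algebra.Properties.CommutativeSemigroup ℕP.*-commutativeSemigroup as ℕ*
  import Data.Nat.Divisibility as ℕ
  open import Data.Nat.GCD using (gcd; gcd[m,n]∣m; gcd[m,n]∣n; gcd[m,n]≢0)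
  open import Data.Integer using (+_)
  open import Data.List using (map; length; upTo; applyUpTo)
  open import Data.Product using (_,_; proj₁; proj₂)
  open import Data.Sum using (inj₂)
  open import Relation.Nullary using (¬_; contradiction)
  open import Relation.Binary.PropositionalEquality as ≡ using (_≡_; cong; subst)

  open PolynomialRing
  open GeometricSums
  open GeometricSumDivisibility
  open SumsAndProducts
  open VanishingAtζ
  open SquarefreeProducts using (∃-prime-∣)
  open CongruenceAtζ x

  private
    V : Poly → Set
    V = VanishesAtζₓ x

  X^-+-multiple : ∀ e j → X^ (e ℕ.+ x ℕ.* j) ∼ X^ e
  X^-+-multiple e j = mk∼ (vanishes-∣ (X^ e * geomSum x j , (begin
    X^ e * geomSum x j * Xⁿ−1 x        ≈⟨ *-assoc (X^ e) (geomSum x j) (Xⁿ−1 x) ⟩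
    X^ e * (geomSum x j * Xⁿ−1 x)      ≈⟨ X^ e *ₗ geomSum-*-Xⁿ−1 x j ⟩
    X^ e * Xⁿ−1 (j ℕ.* x)              ≈⟨ solve 2 (λ a b → a :* (b :- con (+ 1)) := a :* b :- a) ≈-refl (X^ e) (X^ (j ℕ.* x)) ⟩
    X^ e * X^ (j ℕ.* x) - X^ e         ≈⟨ X^-+ e (j ℕ.* x) +ᵣ - X^ e ⟨
    X^ (e ℕ.+ j ℕ.* x) - X^ e          ≡⟨ cong (λ k → X^ (e ℕ.+ k) - X^ e) (ℕP.*-comm j x) ⟩
    X^ (e ℕ.+ x ℕ.* j) - X^ e          ∎)) (Xⁿ−1-vanishes x))
    where open import Relation.Binary.Reasoning.Setoid setoid

  X^-∼1 : ∀ {e} → x ℕ.∣ e → X^ e ∼ 1#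
  X^-∼1 (ℕ.divides j e≡j*x) = subst (λ e → X^ e ∼ 1#) (≡.sym (≡.trans e≡j*x (ℕP.*-comm j x))) (X^-+-multiple 0 j)

  powerSum : ℕ → Poly
  powerSum c = sumₚ (map (λ a → X^ (a ℕ.* c)) (range x))

  powerSum≈X^*geomSum : ∀ c → powerSum c ≈ X^ c * geomSum c x
  powerSum≈X^*geomSum c = begin
    sumₚ (map (λ a → X^ (a ℕ.* c)) (map suc (upTo x)))   ≡⟨ cong sumₚ (≡.sym (map-∘ (upTo x))) ⟩
    sumₚ (map (λ i → X^ (suc i ℕ.* c)) (upTo x))         ≡⟨ cong sumₚ (map-upTo _ x) ⟩
    sumₚ (applyUpTo (λ i → X^ (suc i ℕ.* c)) x)          ≈⟨ sumₚ-geometric c _ (λ i → X^-+ c (suc i ℕ.* c)) x ⟩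
    X^ (c ℕ.+ 0) * geomSum c x                           ≡⟨ cong (λ k → X^ k * geomSum c x) (ℕP.+-identityʳ c) ⟩
    X^ c * geomSum c x                                   ∎
    where open import Relation.Binary.Reasoning.Setoid setoid
          open import Data.List.Properties using (map-∘; map-upTo)

  powerSum-∣ : ∀ {c} → x ℕ.∣ c → powerSum c ∼ constₚ (+ x)
  powerSum-∣ {c} x∣c = begin
    powerSum c                              ∼⟨ sumₚ-cong-∼ (range x) (λ {a} _ → X^-∼1 (ℕ.∣n⇒∣m*n a x∣c)) ⟩
    sumₚ (map (λ _ → 1#) (range x))         ≈⟨ sumₚ-ones (range x) ⟩
    constₚ (+ length (range x))             ≡⟨ cong (λ n → constₚ (+ n)) (≡.trans (length-map suc (upTo x)) (length-upTo x)) ⟩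
    constₚ (+ x)                            ∎
    where open ∼-Reasoning
          open import Data.List.Properties using (length-map; length-upTo)

  -- With g = gcd c x and x = n g, n ≥ 2 has a prime factor p, and geomSum c x is a multiple of
  -- geomSum g n, hence of geomSum (x / p) p, which vanishes.
  geomSum-∤-vanishes : ∀ {c} → ¬ x ℕ.∣ c → V (geomSum c x)
  geomSum-∤-vanishes {c} x∤c =
    vanishes-∣ (∣ʳ-trans geomSumₚ∣geomSumₙ (geomSum-gcd-∣ c x {n} x≡n*g)) (geomSum-vanishes p-prime w*p≡x)
    where
    g = gcd c x
    instance
      g≢0 : NonZero g
      g≢0 = ℕ.≢-nonZero (gcd[m,n]≢0 c x (inj₂ (ℕ.≢-nonZero⁻¹ x)))
    n = ℕ.quotient (gcd[m,n]∣n c x)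
    x≡n*g : x ≡ n ℕ.* g
    x≡n*g = ℕ._∣_.equality (gcd[m,n]∣n c x)
    2≤n : ∀ n → x ≡ n ℕ.* g → 2 ≤ n
    2≤n zero          x≡0   = contradiction x≡0 (ℕ.≢-nonZero⁻¹ x)
    2≤n (suc zero)    x≡g+0 = contradiction (subst (ℕ._∣ c) (≡.sym (≡.trans x≡g+0 (ℕP.+-identityʳ g))) (gcd[m,n]∣m c x)) x∤c
    2≤n (suc (suc _)) _     = s≤s (s≤s z≤n)
    p-factor = ∃-prime-∣ n (2≤n n x≡n*g)
    p = proj₁ p-factor
    p-prime = proj₁ (proj₂ p-factor)
    n′ = ℕ.quotient (proj₂ (proj₂ p-factor))
    n≡n′*p : n ≡ n′ ℕ.* p
    n≡n′*p = ℕ._∣_.equality (proj₂ (proj₂ p-factor))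
    w*p≡x : n′ ℕ.* g ℕ.* p ≡ x
    w*p≡x = ≡.sym (≡.trans x≡n*g (≡.trans (cong (ℕ._* g) n≡n′*p) (ℕ*.xy∙z≈xz∙y n′ p g)))
    geomSumₚ∣geomSumₙ : geomSum (n′ ℕ.* g) p ∣ geomSum g n
    geomSumₚ∣geomSumₙ = geomSum g n′ , ≈-trans (≈-sym (geomSum-* g n′ p))
                                               (≡⇒≈ (cong (geomSum g) (≡.trans (ℕP.*-comm p n′) (≡.sym n≡n′*p))))

  powerSum-∤ : ∀ {c} → ¬ x ℕ.∣ c → powerSum c ∼ 0#
  powerSum-∤ {c} x∤c =
    vanishes⇒∼0 (vanishes-resp-≈ (≈-sym (powerSum≈X^*geomSum c)) (vanishes-∣ (X^ c , ≈-refl) (geomSum-∤-vanishes x∤c)))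

module NaturalSums where

  open import Data.Nat as ℕ using (ℕ; suc; _+_; _*_; _≤_)
  import Data.Nat.Properties as ℕP
  open import Data.Nat.DivMod using (_%_; [m+kn]%n≡m%n; m<n⇒m%n≡m)
  open import Data.Nat.ListAction using (sum)
  open import Data.Bool using (Bool; true; false; T; _∧_; if_then_else_)
  open import Data.List.Properties using (filter-≐)
  open import Data.Product using (_,_)
  open import Relation.Nullary.Decidable using (T?)
  open import Data.List using ([]; _∷_; map; filterᵇ; length)
  open import Data.List.Membership.Propositional using (_∈_)
  open import Data.List.Relation.Unary.Any using (here; there)
  import Data.List.Relation.Unary.All as All
  open import Data.List.Relation.Unary.Unique.Propositional using (Unique; _∷_)
  open import Function using (_∘_)
  open import Relation.Binary.PropositionalEquality as ≡ using (_≡_; _≢_; refl; cong; cong₂; subst)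
  open ≡.≡-Reasoning

  module _ {A : Set} where

    sum-cong : ∀ {f g : A → ℕ} xs → (∀ {a} → a ∈ xs → f a ≡ g a) → sum (map f xs) ≡ sum (map g xs)
    sum-cong []       f≡g = refl
    sum-cong (x ∷ xs) f≡g = cong₂ _+_ (f≡g (here refl)) (sum-cong xs (f≡g ∘ there))

    sum-zero : ∀ {f : A → ℕ} xs → (∀ {a} → a ∈ xs → f a ≡ 0) → sum (map f xs) ≡ 0
    sum-zero []       f≡0 = refl
    sum-zero (x ∷ xs) f≡0 = cong₂ _+_ (f≡0 (here refl)) (sum-zero xs (f≡0 ∘ there))

    sum-*ˡ : ∀ c (f : A → ℕ) xs → sum (map (λ a → c * f a) xs) ≡ c * sum (map f xs)
    sum-*ˡ c f []       = ≡.sym (ℕP.*-zeroʳ c)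
    sum-*ˡ c f (x ∷ xs) = ≡.trans (cong (c * f x +_) (sum-*ˡ c f xs)) (≡.sym (ℕP.*-distribˡ-+ c (f x) _))

    sum-single : ∀ {f : A → ℕ} {k xs} → Unique xs → k ∈ xs → (∀ {l} → l ∈ xs → l ≢ k → f l ≡ 0) → sum (map f xs) ≡ f k
    sum-single {f} {k} {k ∷ xs} (k∉xs ∷ _) (here refl) f≡0 =
      ≡.trans (cong (f k +_) (sum-zero xs λ l∈ → f≡0 (there l∈) (λ l≡k → All.lookup k∉xs l∈ (≡.sym l≡k)))) (ℕP.+-identityʳ _)
    sum-single {f} {k} {y ∷ xs} (y∉xs ∷ xs-unique) (there k∈) f≡0 =
      ≡.trans (cong (_+ sum (map f xs)) (f≡0 (here refl) (λ y≡k → All.lookup y∉xs k∈ y≡k)))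
              (sum-single xs-unique k∈ (f≡0 ∘ there))

    filterᵇ-cong : ∀ {f g : A → Bool} xs → (∀ a → f a ≡ g a) → filterᵇ f xs ≡ filterᵇ g xs
    filterᵇ-cong {f} {g} xs f≡g = filter-≐ (T? ∘ f) (T? ∘ g) ((λ {a} → subst T (f≡g a)) , (λ {a} → subst T (≡.sym (f≡g a)))) xs

    sum-indicator-filterᵇ : ∀ (p f : A → Bool) xs →
      sum (map (λ k → if f k then 1 else 0) (filterᵇ p xs)) ≡ length (filterᵇ (λ k → p k ∧ f k) xs)
    sum-indicator-filterᵇ p f []       = refl
    sum-indicator-filterᵇ p f (y ∷ ys) with p y
    ... | false = sum-indicator-filterᵇ p f ys
    ... | true with f y
    ...   | true  = cong suc (sum-indicator-filterᵇ p f ys)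
    ...   | false = sum-indicator-filterᵇ p f ys

  -- Residues are taken in 1 … q, the range used for reduced residues below.
  residue-unique : ∀ {q k l a b} → 1 ≤ k → k ≤ q → 1 ≤ l → l ≤ q → k + a * q ≡ l + b * q → k ≡ l
  residue-unique {q@(suc _)} {suc k} {suc l} {a} {b} _ k<q _ l<q eq = cong suc (begin
    k                ≡⟨ m<n⇒m%n≡m k<q ⟨
    k % q            ≡⟨ [m+kn]%n≡m%n k a q ⟨
    (k + a * q) % q  ≡⟨ cong (_% q) (ℕP.suc-injective eq) ⟩
    (l + b * q) % q  ≡⟨ [m+kn]%n≡m%n l b q ⟩
    l % q            ≡⟨ m<n⇒m%n≡m l<q ⟩
    l                ∎)

module Counting where

  open import Data.Nat as ℕ using (ℕ; _+_; _*_; _∸_; _≤_; NonZero)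
  import Data.Nat.Properties as ℕP
  open import Data.Nat.Divisibility using (_∣_; _∣?_; divides; ∣-antisym; ∣m+n∣m⇒∣n; n/m≡quotient; m%n≡0⇔n∣m; *-cancelʳ-∣; *-monoˡ-∣)
  open import Data.Nat.DivMod using (_/_; _%_)
  open import Data.Nat.GCD using (gcd)
  open import Data.Nat.Coprimality as Coprime using (Coprime; coprime-divisor; gcd≡1⇒coprime)
  open import Data.Nat.ListAction using (sum)
  open import Data.Bool using (_∧_; if_then_else_)
  open import Data.Nat.Tactic.RingSolver using (solve)
  open import Data.List using (List; []; _∷_; map; filterᵇ; length)
  open import Data.List.Membership.Propositional using (_∈_)
  open import Data.List.Relation.Unary.Unique.Propositional using (Unique)
  import Data.List.Relation.Unary.Unique.Propositional.Properties as Unique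
  open import Data.Product using (_×_; _,_; proj₁; proj₂)
  open import Function using (_∘_; _⇔_; mk⇔; Equivalence)
  open import Relation.Nullary using (¬_; does; yes; no)
  open import Relation.Nullary.Decidable using (dec-true; dec-false; does-⇔)
  open import Relation.Binary.PropositionalEquality as ≡ using (_≡_; _≢_; refl; cong; cong₂; subst; subst₂)
  open ≡.≡-Reasoning

  open NaturalSums
  open FiltersAndRanges using (∈-filterᵇ⁻; ∈-range⁻; range-unique; T-does⁻)

  ∸1*+≡* : ∀ {x} c → 1 ≤ x → (x ∸ 1) * c + c ≡ x * c
  ∸1*+≡* {x} c 1≤x = begin
    (x ∸ 1) * c + c       ≡⟨ cong ((x ∸ 1) * c +_) (ℕP.*-identityˡ c) ⟨
    (x ∸ 1) * c + 1 * c   ≡⟨ ℕP.*-distribʳ-+ c (x ∸ 1) 1 ⟨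
    (x ∸ 1 + 1) * c       ≡⟨ cong (_* c) (ℕP.m∸n+n≡m 1≤x) ⟩
    x * c                 ∎

  -- l β + (x − 1) k α ≡ 0 (mod x) says l β ≡ k α (mod x); for x = α q = β r, scaling by q r / x
  -- clears the denominators.
  cleared-congruence : ∀ {x q r α β k l u} → x ≡ α * q → x ≡ β * r → .{{_ : NonZero x}} →
                       l * β + (x ∸ 1) * (k * α) ≡ u * x → q * l + q * r * (k * α) ≡ q * r * u + k * r
  cleared-congruence {x} {q} {r} {α} {β} {k} {l} {u} x≡α*q x≡β*r eq = ℕP.*-cancelˡ-≡ _ _ β (begin
    β * (q * l + q * r * (k * α))     ≡⟨ solve (β ∷ q ∷ l ∷ r ∷ k ∷ α ∷ []) ⟩
    q * (l * β + β * r * (k * α))     ≡⟨ cong (λ y → q * (l * β + y * (k * α))) x≡β*r ⟨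
    q * (l * β + x * (k * α))         ≡⟨ cong (q *_) add-kα ⟨
    q * (u * x + k * α)               ≡⟨ solve (q ∷ u ∷ x ∷ k ∷ α ∷ []) ⟩
    u * q * x + k * (α * q)           ≡⟨ cong₂ (λ y z → u * q * y + k * z) x≡β*r (≡.trans (≡.sym x≡α*q) x≡β*r) ⟩
    u * q * (β * r) + k * (β * r)     ≡⟨ solve (u ∷ q ∷ β ∷ r ∷ k ∷ []) ⟩
    β * (q * r * u + k * r)           ∎)
    where
    instance
      β≢0 : NonZero β
      β≢0 = ℕ.≢-nonZero λ β≡0 → ℕ.≢-nonZero⁻¹ x (≡.trans x≡β*r (cong (_* r) β≡0))
    add-kα : u * x + k * α ≡ l * β + x * (k * α)
    add-kα = begin
      u * x + k * α                       ≡⟨ cong (_+ k * α) eq ⟨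
      l * β + (x ∸ 1) * (k * α) + k * α   ≡⟨ ℕP.+-assoc (l * β) _ _ ⟩
      l * β + ((x ∸ 1) * (k * α) + k * α) ≡⟨ cong (l * β +_) (∸1*+≡* (k * α) (ℕ.>-nonZero⁻¹ x)) ⟩
      l * β + x * (k * α)                 ∎

  -- From q l + q r k α = q r u + k r: r ∣ q l and q ∣ k r, so q = r by coprimality, and then
  -- l + (k α) q = k + u q makes k and l congruent residues in 1 … q.
  x∣lβ-kα⇒≡ : ∀ {x q r α β k l u} → x ≡ α * q → x ≡ β * r → .{{_ : NonZero x}} →
              1 ≤ k → k ≤ q → Coprime k q → 1 ≤ l → l ≤ r → Coprime l r →
              l * β + (x ∸ 1) * (k * α) ≡ u * x → q ≡ r × k ≡ l
  x∣lβ-kα⇒≡ {x} {q} {r} {α} {β} {k} {l} {u} x≡α*q x≡β*r 1≤k k≤q k⊥q 1≤l l≤r l⊥r eq = q≡r , k≡l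
    where
    qr-eq : q * l + q * r * (k * α) ≡ q * r * u + k * r
    qr-eq = cleared-congruence {x} {q} {r} {α} {β} {k} {l} {u} x≡α*q x≡β*r eq
    r∣q*l : r ∣ q * l
    r∣q*l = ∣m+n∣m⇒∣n (subst (r ∣_) (≡.trans (≡.sym qr-eq) (ℕP.+-comm (q * l) _)) (divides (q * u + k) (solve (q ∷ r ∷ u ∷ k ∷ []))))
                      (divides (q * (k * α)) (solve (q ∷ r ∷ k ∷ α ∷ [])))
    q∣k*r : q ∣ k * r
    q∣k*r = ∣m+n∣m⇒∣n (subst (q ∣_) qr-eq (divides (l + r * (k * α)) (solve (q ∷ l ∷ r ∷ k ∷ α ∷ []))))
                      (divides (r * u) (solve (q ∷ r ∷ u ∷ [])))
    q≡r : q ≡ r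
    q≡r = ∣-antisym (coprime-divisor (Coprime.sym k⊥q) q∣k*r)
                    (coprime-divisor (Coprime.sym l⊥r) (subst (r ∣_) (ℕP.*-comm q l) r∣q*l))
    instance
      q≢0 : NonZero q
      q≢0 = ℕ.>-nonZero (ℕP.≤-trans 1≤k k≤q)
    k≡l : k ≡ l
    k≡l = ≡.sym (residue-unique {q} {l} {k} {k * α} {u} 1≤l (subst (l ≤_) (≡.sym q≡r) l≤r) 1≤k k≤q (ℕP.*-cancelˡ-≡ _ _ q (begin
      q * (l + k * α * q)               ≡⟨ solve (q ∷ l ∷ k ∷ α ∷ []) ⟩
      q * l + q * q * (k * α)           ≡⟨ subst (λ r → q * l + q * r * (k * α) ≡ q * r * u + k * r) (≡.sym q≡r) qr-eq ⟩
      q * q * u + k * q                 ≡⟨ solve (q ∷ u ∷ k ∷ []) ⟩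
      q * (k + u * q)                   ∎)))

  reducedResidues : ℕ → List ℕ
  reducedResidues n = filterᵇ (λ k → coprime? k n) (range n)

  ∈-reducedResidues⁻ : ∀ {n k} → k ∈ reducedResidues n → 1 ≤ k × k ≤ n × Coprime k n
  ∈-reducedResidues⁻ {n} {k} k∈ =
    let k∈range , k⊥n = ∈-filterᵇ⁻ _ (range n) k∈
        1≤k , k≤n = ∈-range⁻ k∈range
    in 1≤k , k≤n , gcd≡1⇒coprime (T-does⁻ (gcd k n ℕ.≟ 1) k⊥n)

  reducedResidues-unique : ∀ n → Unique (reducedResidues n)
  reducedResidues-unique n = Unique.filter⁺ _ (range-unique n)

  module Orthogonality {x q r : ℕ} .{{_ : NonZero x}} .{{_ : NonZero q}} .{{_ : NonZero r}} (q∣x : q ∣ x) (r∣x : r ∣ x) where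

    α β : ℕ
    α = x / q
    β = x / r

    x≡α*q : x ≡ α * q
    x≡α*q = ≡.trans (_∣_.equality q∣x) (cong (_* q) (≡.sym (n/m≡quotient q∣x)))

    x≡β*r : x ≡ β * r
    x≡β*r = ≡.trans (_∣_.equality r∣x) (cong (_* r) (≡.sym (n/m≡quotient r∣x)))

    -- With ζ = exp(2πi / x), the (k, l)-term of c_q(m − a) S(a, m; r) is ζ^(m · mExponent k l + a · aExponent k l).
    mExponent aExponent : ℕ → ℕ → ℕ
    mExponent k l = k * α + inv r l * β
    aExponent k l = l * β + (x ∸ 1) * (k * α)

    δ : ℕ → ℕ
    δ c = if does (x ∣? c) then 1 else 0

    weight : ℕ → ℕ → ℕ
    weight k l = δ (mExponent k l) * δ (aExponent k l)

    totalWeight : ℕ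
    totalWeight = sum (map (λ k → sum (map (weight k) (reducedResidues r))) (reducedResidues q))

    weight-≡0 : ∀ {k l} → k ∈ reducedResidues q → l ∈ reducedResidues r → ¬ (q ≡ r × k ≡ l) → weight k l ≡ 0
    weight-≡0 {k} {l} k∈ l∈ ¬q≡r×k≡l =
      ≡.trans (cong (λ b → δ (mExponent k l) * (if b then 1 else 0)) (dec-false (x ∣? aExponent k l) x∤aExponent))
              (ℕP.*-zeroʳ (δ (mExponent k l)))
      where
      x∤aExponent : ¬ x ∣ aExponent k l
      x∤aExponent (divides u aExp≡u*x) =
        let 1≤k , k≤q , k⊥q = ∈-reducedResidues⁻ k∈
            1≤l , l≤r , l⊥r = ∈-reducedResidues⁻ l∈
        in ¬q≡r×k≡l (x∣lβ-kα⇒≡ {u = u} x≡α*q x≡β*r 1≤k k≤q k⊥q 1≤l l≤r l⊥r aExp≡u*x)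

    totalWeight-≢ : q ≢ r → totalWeight ≡ 0
    totalWeight-≢ q≢r = sum-zero _ λ k∈ → sum-zero _ λ l∈ → weight-≡0 k∈ l∈ (q≢r ∘ proj₁)

  totalWeight-diagonal : ∀ {x q} .{{_ : NonZero x}} .{{_ : NonZero q}} (q∣x : q ∣ x) →
                         Orthogonality.totalWeight q∣x q∣x ≡ φ̃ q
  totalWeight-diagonal {x} {q} q∣x = begin
    totalWeight                                                                  ≡⟨ sum-cong Ks row-sum ⟩
    sum (map (λ k → δ (mExponent k k)) Ks)                                      ≡⟨ sum-indicator-filterᵇ _ _ (range q) ⟩
    length (filterᵇ (λ k → coprime? k q ∧ does (x ∣? mExponent k k)) (range q)) ≡⟨ cong length (filterᵇ-cong (range q) x∣mExponent≡) ⟩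
    φ̃ q                                                                         ∎
    where
    open Orthogonality q∣x q∣x
    Ks = reducedResidues q
    instance
      α≢0 : NonZero α
      α≢0 = ℕ.≢-nonZero λ α≡0 → ℕ.≢-nonZero⁻¹ x (≡.trans x≡α*q (cong (_* q) α≡0))
    x∣aExponent : ∀ k → x ∣ aExponent k k
    x∣aExponent k = divides (k * α) (begin
      k * α + (x ∸ 1) * (k * α)    ≡⟨ ℕP.+-comm (k * α) _ ⟩
      (x ∸ 1) * (k * α) + k * α    ≡⟨ ∸1*+≡* (k * α) (ℕ.>-nonZero⁻¹ x) ⟩
      x * (k * α)                  ≡⟨ ℕP.*-comm x (k * α) ⟩
      k * α * x                    ∎)
    row-sum : ∀ {k} → k ∈ Ks → sum (map (weight k) Ks) ≡ δ (mExponent k k)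
    row-sum {k} k∈ = begin
      sum (map (weight k) Ks)   ≡⟨ sum-single (reducedResidues-unique q) k∈ (λ l∈ l≢k → weight-≡0 k∈ l∈ (l≢k ∘ ≡.sym ∘ proj₂)) ⟩
      weight k k                ≡⟨ cong (λ b → δ (mExponent k k) * (if b then 1 else 0)) (dec-true (x ∣? aExponent k k) (x∣aExponent k)) ⟩
      δ (mExponent k k) * 1     ≡⟨ ℕP.*-identityʳ _ ⟩
      δ (mExponent k k)         ∎
    x∣mExponent⇔ : ∀ k → x ∣ mExponent k k ⇔ (k + inv q k) % q ≡ 0
    x∣mExponent⇔ k = mk⇔
      (λ x∣ → Equivalence.from (m%n≡0⇔n∣m _ q) (*-cancelʳ-∣ α (subst₂ _∣_ x≡q*α (≡.sym (ℕP.*-distribʳ-+ α k (inv q k))) x∣)))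
      (λ ≡0 → subst₂ _∣_ (≡.sym x≡q*α) (ℕP.*-distribʳ-+ α k (inv q k)) (*-monoˡ-∣ α (Equivalence.to (m%n≡0⇔n∣m _ q) ≡0)))
      where x≡q*α = ≡.trans x≡α*q (ℕP.*-comm α q)
    x∣mExponent≡ : ∀ k → (coprime? k q ∧ does (x ∣? mExponent k k)) ≡ (coprime? k q ∧ does ((k + inv q k) % q ℕ.≟ 0))
    x∣mExponent≡ k = cong (coprime? k q ∧_) (does-⇔ (x∣mExponent⇔ k) (x ∣? mExponent k k) ((k + inv q k) % q ℕ.≟ 0))

  totalWeight≡ : ∀ {x q r} .{{_ : NonZero x}} .{{q≢0 : NonZero q}} .{{_ : NonZero r}} (q∣x : q ∣ x) (r∣x : r ∣ x) →
                 Orthogonality.totalWeight q∣x r∣x ≡ (if does (q ℕ.≟ r) then φ̃ q else 0)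
  totalWeight≡ {q = q} {r} {{x≢0}} {{q≢0}} q∣x r∣x with q ℕ.≟ r
  ... | yes refl = ≡.trans (totalWeight-diagonal {{x≢0}} {{q≢0}} q∣x) (cong (λ b → if b then φ̃ q else 0) (≡.sym (dec-true (q ℕ.≟ q) refl)))
  ... | no q≢r   = ≡.trans (Orthogonality.totalWeight-≢ q∣x r∣x q≢r) (cong (λ b → if b then φ̃ q else 0) (≡.sym (dec-false (q ℕ.≟ r) q≢r)))

open import Data.Nat.Divisibility using (_∣_)

module ExponentialSum {x q r : ℕ} .{{_ : NonZero x}} .{{_ : NonZero q}} .{{_ : NonZero r}} (q∣x : q ∣ x) (r∣x : r ∣ x) where

  open import Data.Nat as ℕ using (suc; _≤_)
  import Data.Nat.Properties as ℕP
  open import Data.Nat.Divisibility using (_∣?_)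
  open import Data.Nat.Tactic.RingSolver using (solve-∀)
  open import Data.Nat.ListAction using () renaming (sum to sumℕ)
  open import Data.Integer using (+_)
  open import Data.List using (map)
  open import Data.List.Membership.Propositional using (_∈_)
  open import Data.Product using (proj₁; proj₂)
  open import Relation.Nullary using (yes; no)
  open import Relation.Binary.PropositionalEquality as ≡ using (_≡_; cong; cong₂)

  open PolynomialRing
  open GeometricSums using (X^_; X^-+; X^-cong)
  open SumsAndProducts
  open CongruenceAtζ x
  open PowerSumsAtζ x
  open Counting using (reducedResidues; module Orthogonality)
  open Orthogonality q∣x r∣x
  open FiltersAndRanges using (∈-range⁻)

  exponent : ℕ → ℕ → ℕ → ℕ → ℕ
  exponent m a k l = k ℕ.* (m ℕ.+ x ℕ.∸ a) ℕ.* α ℕ.+ (a ℕ.* l ℕ.+ m ℕ.* inv r l) ℕ.* β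

  private
    rearrange : ∀ m a′ b k l l′ α β →
      k ℕ.* (m ℕ.+ b) ℕ.* α ℕ.+ (suc a′ ℕ.* l ℕ.+ m ℕ.* l′) ℕ.* β ℕ.+ (suc a′ ℕ.+ b) ℕ.* (k ℕ.* α ℕ.* a′)
        ≡ m ℕ.* (k ℕ.* α ℕ.+ l′ ℕ.* β) ℕ.+ suc a′ ℕ.* (l ℕ.* β ℕ.+ (a′ ℕ.+ b) ℕ.* (k ℕ.* α))
    rearrange = solve-∀

  exponent-split : ∀ m {a} → 1 ≤ a → a ≤ x → ∀ k l →
                   exponent m a k l ℕ.+ x ℕ.* (k ℕ.* α ℕ.* (a ℕ.∸ 1)) ≡ m ℕ.* mExponent k l ℕ.+ a ℕ.* aExponent k l
  exponent-split m {suc a′} _ a≤x k l = begin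
    exponent m (suc a′) k l ℕ.+ x ℕ.* (k ℕ.* α ℕ.* a′)
      ≡⟨ cong₂ (λ y z → k ℕ.* y ℕ.* α ℕ.+ (suc a′ ℕ.* l ℕ.+ m ℕ.* inv r l) ℕ.* β ℕ.+ z ℕ.* (k ℕ.* α ℕ.* a′))
               (ℕP.+-∸-assoc m a≤x) x≡a+b ⟩
    k ℕ.* (m ℕ.+ b) ℕ.* α ℕ.+ (suc a′ ℕ.* l ℕ.+ m ℕ.* inv r l) ℕ.* β ℕ.+ (suc a′ ℕ.+ b) ℕ.* (k ℕ.* α ℕ.* a′)
      ≡⟨ rearrange m a′ b k l (inv r l) α β ⟩
    m ℕ.* mExponent k l ℕ.+ suc a′ ℕ.* (l ℕ.* β ℕ.+ (a′ ℕ.+ b) ℕ.* (k ℕ.* α))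
      ≡⟨ cong (λ y → m ℕ.* mExponent k l ℕ.+ suc a′ ℕ.* (l ℕ.* β ℕ.+ y ℕ.* (k ℕ.* α))) x∸1≡a′+b ⟨
    m ℕ.* mExponent k l ℕ.+ suc a′ ℕ.* aExponent k l ∎
    where
    open ≡.≡-Reasoning
    b = x ℕ.∸ suc a′
    x≡a+b : x ≡ suc a′ ℕ.+ b
    x≡a+b = ≡.sym (ℕP.m+[n∸m]≡n a≤x)
    x∸1≡a′+b : x ℕ.∸ 1 ≡ a′ ℕ.+ b
    x∸1≡a′+b = cong (ℕ._∸ 1) x≡a+b

  term-split : ∀ m {a} → a ∈ range x → ∀ k l → X^ (exponent m a k l) ∼ X^ (m ℕ.* mExponent k l) * X^ (a ℕ.* aExponent k l)
  term-split m {a} a∈ k l = begin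
    X^ (exponent m a k l)                                      ∼⟨ ∼-sym (X^-+-multiple (exponent m a k l) (k ℕ.* α ℕ.* (a ℕ.∸ 1))) ⟩
    X^ (exponent m a k l ℕ.+ x ℕ.* (k ℕ.* α ℕ.* (a ℕ.∸ 1)))    ≈⟨ X^-cong (exponent-split m (proj₁ (∈-range⁻ a∈)) (proj₂ (∈-range⁻ a∈)) k l) ⟩
    X^ (m ℕ.* mExponent k l ℕ.+ a ℕ.* aExponent k l)           ≈⟨ X^-+ (m ℕ.* mExponent k l) (a ℕ.* aExponent k l) ⟩
    X^ (m ℕ.* mExponent k l) * X^ (a ℕ.* aExponent k l)        ∎
    where open ∼-Reasoning

  powerSum∼δ : ∀ c → powerSum c ∼ constₚ (+ (x ℕ.* δ c))
  powerSum∼δ c with x ∣? c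
  ... | yes x∣c = ∼-trans (powerSum-∣ x∣c) (≈⇒∼ (≡⇒≈ (cong (λ n → constₚ (+ n)) (≡.sym (ℕP.*-identityʳ x)))))
  ... | no  x∤c = ∼-trans (powerSum-∤ x∤c) (≈⇒∼ (≈-trans (≈-sym Polynomial.[0]≈[]) (≡⇒≈ (cong (λ n → constₚ (+ n)) (≡.sym (ℕP.*-zeroʳ x))))))

  block : ℕ → ℕ → Poly
  block k l = sumₚ (map (λ m → sumₚ (map (λ a → X^ (exponent m a k l)) (range x))) (range x))

  block∼weight : ∀ k l → block k l ∼ constₚ (+ (x ℕ.* x ℕ.* weight k l))
  block∼weight k l = begin
    sumₚ (map (λ m → sumₚ (map (λ a → X^ (exponent m a k l)) (range x))) (range x))
      ∼⟨ sumₚ-cong-∼ (range x) (λ {m} _ → sumₚ-cong-∼ (range x) (λ a∈ → term-split m a∈ k l)) ⟩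
    sumₚ (map (λ m → sumₚ (map (λ a → X^ (m ℕ.* mExponent k l) * X^ (a ℕ.* aExponent k l)) (range x))) (range x))
      ≈⟨ sumₚ-*-sumₚ (λ m → X^ (m ℕ.* mExponent k l)) (λ a → X^ (a ℕ.* aExponent k l)) (range x) (range x) ⟩
    powerSum (mExponent k l) * powerSum (aExponent k l)
      ∼⟨ *-cong-∼ (powerSum∼δ (mExponent k l)) (powerSum∼δ (aExponent k l)) ⟩
    constₚ (+ (x ℕ.* δ (mExponent k l))) * constₚ (+ (x ℕ.* δ (aExponent k l)))
      ≈⟨ constₚ-*-constₚ (x ℕ.* δ (mExponent k l)) (x ℕ.* δ (aExponent k l)) ⟩
    constₚ (+ (x ℕ.* δ (mExponent k l) ℕ.* (x ℕ.* δ (aExponent k l))))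
      ≡⟨ cong (λ n → constₚ (+ n)) (interchange x (δ (mExponent k l)) x (δ (aExponent k l))) ⟩
    constₚ (+ (x ℕ.* x ℕ.* weight k l))
      ∎
    where open ∼-Reasoning
          open import Algebra.Properties.CommutativeSemigroup ℕP.*-commutativeSemigroup using (interchange)

  ΣΣ : (ℕ → ℕ → Poly) → Poly
  ΣΣ f = sumₚ (map (λ k → sumₚ (map (f k) (reducedResidues r))) (reducedResidues q))

  lhsPoly≈ΣΣblock : lhsPoly x q r ≈ ΣΣ block
  lhsPoly≈ΣΣblock = begin
    lhsPoly x q r
      ≈⟨ sumₚ-cong R (λ m → sumₚ-comm (λ a k → sumₚ (map (λ l → X^ (exponent m a k l)) Ls)) R Ks) ⟩
    sumₚ (map (λ m → sumₚ (map (λ k → sumₚ (map (λ a → sumₚ (map (λ l → X^ (exponent m a k l)) Ls)) R)) Ks)) R)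
      ≈⟨ sumₚ-cong R (λ m → sumₚ-cong Ks (λ k → sumₚ-comm (λ a l → X^ (exponent m a k l)) R Ls)) ⟩
    sumₚ (map (λ m → sumₚ (map (λ k → sumₚ (map (λ l → sumₚ (map (λ a → X^ (exponent m a k l)) R)) Ls)) Ks)) R)
      ≈⟨ sumₚ-comm (λ m k → sumₚ (map (λ l → sumₚ (map (λ a → X^ (exponent m a k l)) R)) Ls)) R Ks ⟩
    sumₚ (map (λ k → sumₚ (map (λ m → sumₚ (map (λ l → sumₚ (map (λ a → X^ (exponent m a k l)) R)) Ls)) R)) Ks)
      ≈⟨ sumₚ-cong Ks (λ k → sumₚ-comm (λ m l → sumₚ (map (λ a → X^ (exponent m a k l)) R)) R Ls) ⟩
    ΣΣ block
      ∎
    where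
    open import Relation.Binary.Reasoning.Setoid setoid
    R  = range x
    Ks = reducedResidues q
    Ls = reducedResidues r

  ΣΣ-cong-∼ : ∀ {f g} → (∀ k l → f k l ∼ g k l) → ΣΣ f ∼ ΣΣ g
  ΣΣ-cong-∼ f∼g = sumₚ-cong-∼ (reducedResidues q) (λ {k} _ → sumₚ-cong-∼ (reducedResidues r) (λ {l} _ → f∼g k l))

  ΣΣ-weights : ΣΣ (λ k l → constₚ (+ (x ℕ.* x ℕ.* weight k l))) ≈ constₚ (+ (x ℕ.* x ℕ.* totalWeight))
  ΣΣ-weights = begin
    ΣΣ (λ k l → constₚ (+ (x ℕ.* x ℕ.* weight k l)))
      ≈⟨ sumₚ-cong Ks (λ k → ≈-trans (sumₚ-const (λ l → x ℕ.* x ℕ.* weight k l) Ls)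
                                      (≡⇒≈ (cong (λ n → constₚ (+ n)) (sum-*ˡ (x ℕ.* x) (weight k) Ls)))) ⟩
    sumₚ (map (λ k → constₚ (+ (x ℕ.* x ℕ.* sumℕ (map (weight k) Ls)))) Ks)
      ≈⟨ sumₚ-const (λ k → x ℕ.* x ℕ.* sumℕ (map (weight k) Ls)) Ks ⟩
    constₚ (+ sumℕ (map (λ k → x ℕ.* x ℕ.* sumℕ (map (weight k) Ls)) Ks))
      ≡⟨ cong (λ n → constₚ (+ n)) (sum-*ˡ (x ℕ.* x) (λ k → sumℕ (map (weight k) Ls)) Ks) ⟩
    constₚ (+ (x ℕ.* x ℕ.* totalWeight))
      ∎
    where
    open import Relation.Binary.Reasoning.Setoid setoid
    open NaturalSums using (sum-*ˡ)
    Ks = reducedResidues q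
    Ls = reducedResidues r

open import Data.Nat using (_*_; _≟_)
import Data.Nat.Properties as ℕP
open import Data.Integer using (+_)
open import Data.Bool using (true; false; if_then_else_)
open import Relation.Nullary using (does)
open import Relation.Binary.PropositionalEquality using (_≡_; refl; cong)

lemma4 : (x q r : ℕ) .{{_ : NonZero x}} .{{_ : NonZero q}} .{{_ : NonZero r}} →
         q ∣ x → r ∣ x → EvalEq x (lhsPoly x q r) (rhsValue x q r)
lemma4 x q r q∣x r∣x = ∼constₚ⇒EvalEq (begin
  lhsPoly x q r                                            ≈⟨ lhsPoly≈ΣΣblock ⟩
  ΣΣ block                                                 ∼⟨ ΣΣ-cong-∼ block∼weight ⟩
  ΣΣ (λ k l → constₚ (+ (x * x * weight k l)))             ≈⟨ ΣΣ-weights ⟩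
  constₚ (+ (x * x * totalWeight))                         ≡⟨ cong (λ n → constₚ (+ (x * x * n))) (Counting.totalWeight≡ q∣x r∣x) ⟩
  constₚ (+ (x * x * (if does (q ≟ r) then φ̃ q else 0)))  ≡⟨ cong constₚ (+-*-if (does (q ≟ r))) ⟩
  constₚ (rhsValue x q r)                                  ∎)
  where
  open CongruenceAtζ x
  open ∼-Reasoning
  open ExponentialSum q∣x r∣x
  open Counting.Orthogonality q∣x r∣x using (weight; totalWeight)
  +-*-if : ∀ b → + (x * x * (if b then φ̃ q else 0)) ≡ (if b then + (x * x * φ̃ q) else + 0)
  +-*-if true  = refl
  +-*-if false = cong +_ (ℕP.*-zeroʳ (x * x))
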